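{- Fix $r\ge 1$. For $1\le j\le r$ let $x_j=e^{z_j}$ and $y_j=e^{w_j}$, and suppose $x_1\cdots x_r=y_1\cdots y_r$ (i.e. $w_r=z_1+\cdots+z_r-w_1-\cdots-w_{r-1}$). Then $$\prod_{j=1}^r\frac{(x_jq)_\infty}{(y_jq)_\infty}\in\mathbf{qMZV}[[z_1,\dots,z_r,w_1,\dots,w_{r-1}]],$$ its constant term is $1$, and the coefficient of $z_1^{m_1}\cdots z_r^{m_r}w_1^{n_1}\cdots w_{r-1}^{n_{r-1}}$ has weight $m_1+\cdots+m_r+n_1+\cdots+n_{r-1}$.
   Context: Here $q$ is a formal variable and $(a)_\infty=(a;q)_\infty=\prod_{n\ge 0}(1-aq^n)$; all expressions are regarded as formal power series. For integers $s_1,\dots,s_\ell\ge 1$ the bracket is $$[s_1,\dots,s_\ell]=\frac{1}{(s_1-1)!\cdots(s_\ell-1)!}\sum_{\substack{n_1>\cdots>n_\ell\ge 1\\ d_1,\dots,d_\ell\ge 1}} d_1^{s_1-1}\cdots d_\ell^{s_\ell-1}\,q^{n_1d_1+\cdots+n_\ell d_\ell}\in\mathbb{Q}[[q]].$$ $\mathbf{qMZV}$ denotes the $\mathbb{Q}$-linear span of $1$ and Okounkov's multiple $q$-zeta values $Z(s_1,\dots,s_\ell)=\sum_{n_1>\cdots>n_\ell\ge1}\prod_{i=1}^\ell \frac{Q_{s_i}(q^{n_i})}{(1-q^{n_i})^{s_i}}$ ($s_i\ge 2$), where $Q_s(t)=t^{s/2}$ for $s$ even and $Q_s(t)=t^{(s-1)/2}(t+1)$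 for $s$ odd. It is known (Bachmann–Kühn) that $\mathbf{qMZV}$ is a $\mathbb{Q}$-algebra and equals the $\mathbb{Q}$-linear span of $1$ and all brackets $[s_1,\dots,s_\ell]$ with all $s_i\ge 2$. An element of $\mathbf{qMZV}$ is said to have weight $w$ if it is a $\mathbb{Q}$-linear combination of products of brackets $[s_1,\dots,s_\ell]$ with all entries $\ge 2$, in each of which products the sum of all entries of all factors equals $w$ (the constant $1$ has weight $0$). -}

module Defs where

open import Data.Nat as ℕ using (ℕ; zero; suc; _≤ᵇ_; _≡ᵇ_)
open import Data.Nat.Properties using (_!≢0)
open import Data.Nat.Divisibility using (_∣?_)
open import Data.Nat.DivMod using (_/_)
open import Data.Integer as ℤ using (ℤ; +_)
open import Data.Rational as ℚ using (ℚ; 0ℚ; 1ℚ)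
open import Data.Fin using (Fin)
open import Data.Sum using (_⊎_; inj₁; inj₂)
open import Data.Maybe using (Maybe; just; nothing)
open import Data.Product using (_×_; _,_; ∃)
open import Data.List as List using (List; []; _∷_; _++_; map; concatMap; foldr; upTo; allFin)
open import Data.List.Relation.Unary.All using (All)
open import Data.Bool using (if_then_else_)
open import Data.Nat.ListAction using () renaming (sum to sumℕ)
open import Relation.Nullary.Decidable using (does)
open import Relation.Binary.PropositionalEquality using (_≡_)

-- ℚ[[q]] : a formal power series in q, given by its coefficients.

Series : Set
Series = ℕ → ℚ

sumℚ : List ℚ → ℚ
sumℚ = foldr ℚ._+_ 0ℚ

prodℚ : List ℚ → ℚ
prodℚ = foldr ℚ._*_ 1ℚ

range : ℕ → List ℕ
range N = upTo (suc N)

range1 : ℕ → List ℕ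
range1 N = map suc (upTo N)

oneS : Series
oneS zero    = 1ℚ
oneS (suc _) = 0ℚ

_*S_ : Series → Series → Series
(f *S g) N = sumℚ (map (λ i → f i ℚ.* g (N ℕ.∸ i)) (range N))

prodS : List Series → Series
prodS = foldr _*S_ oneS

_^ℚ_ : ℚ → ℕ → ℚ
c ^ℚ zero  = 1ℚ
c ^ℚ suc m = c ℚ.* (c ^ℚ m)

inv! : ℕ → ℚ
inv! m = (+ 1) ℚ./ (m ℕ.!)
  where instance _ = m !≢0

-- Brackets [s₁,…,s_ℓ] ∈ ℚ[[q]].
-- bracketCount ss b N = Σ over b > n₁ > ⋯ > n_ℓ ≥ 1, d_i ≥ 1 with
--   Σ nᵢ dᵢ = N of Π dᵢ^(sᵢ-1).

bracketCount : List ℕ → ℕ → ℕ → ℕ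
bracketCount []       b N = if N ≡ᵇ 0 then 1 else 0
bracketCount (s ∷ ss) b N =
  sumℕ (concatMap (λ n → map (λ d →
      if n ℕ.* d ≤ᵇ N
        then d ℕ.^ (s ℕ.∸ 1) ℕ.* bracketCount ss n (N ℕ.∸ n ℕ.* d)
        else 0)
    (range1 N)) (range1 (b ℕ.∸ 1)))

-- n₁ ≤ n₁ d₁ ≤ N, so the strict bound N+1 on n₁ loses nothing.
bracket : List ℕ → Series
bracket ss N =
  prodℚ (map (λ s → inv! (s ℕ.∸ 1)) ss) ℚ.* ((+ bracketCount ss (suc N) N) ℚ./ 1)

-- Weight-w elements of qMZV: ℚ-linear combinations of products of
-- brackets with all entries ≥ 2, every product having total weight w.
Term : Set
Term = ℚ × List (List ℕ)

termSeries : Term → Series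
termSeries (c , bs) N = c ℚ.* prodS (map bracket bs) N

TermOk : ℕ → Term → Set
TermOk w (c , bs) = All (All (2 ℕ.≤_)) bs × sumℕ (map sumℕ bs) ≡ w

HasWeight : ℕ → Series → Set
HasWeight w f = ∃ λ (ts : List Term) →
  All (TermOk w) ts × (∀ N → sumℚ (map (λ t → termSeries t N) ts) ≡ f N)

-- Variables z₁..z_r, w₁..w_{r-1} with r = suc k.

Vars : ℕ → Set
Vars k = Fin (suc k) ⊎ Fin k

varList : (k : ℕ) → List (Vars k)
varList k = map inj₁ (allFin (suc k)) ++ map inj₂ (allFin k)

Form : ℕ → Set
Form k = Vars k → ℤ

_+F_ : ∀ {k} → Form k → Form k → Form k
(L +F M) v = L v ℤ.+ M v

_•F_ : ∀ {k} → ℕ → Form k → Form k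
(n •F L) v = (+ n) ℤ.* L v

0F : ∀ {k} → Form k
0F _ = + 0

-- Finite ℚ-linear combinations Σ c · exp(L) ∈ ℚ[[z,w]].
ExpPoly : ℕ → Set
ExpPoly k = List (ℚ × Form k)

_*E_ : ∀ {k} → ExpPoly k → ExpPoly k → ExpPoly k
P *E Q = concatMap (λ { (c , L) → map (λ { (d , M) → (c ℚ.* d , L +F M) }) Q }) P

-- Coefficient of Π_v t_v^{α v} in exp(Σ_v L v · t_v) is Π_v (L v)^{α v}/(α v)!.
coeffExp : ∀ {k} → (Vars k → ℕ) → Form k → ℚ
coeffExp {k} α L = prodℚ (map (λ v → ((L v ℚ./ 1) ^ℚ α v) ℚ.* inv! (α v)) (varList k))

coeffE : ∀ {k} → (Vars k → ℕ) → ExpPoly k → ℚ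
coeffE α P = sumℚ (map (λ { (c , L) → c ℚ.* coeffExp α L }) P)

-- x_j = e^{z_j}
xForm : ∀ {k} → Fin (suc k) → Form k
xForm j (inj₁ i) = if does (Data.Fin._≟_ i j) then + 1 else + 0
xForm j (inj₂ i) = + 0

-- y_j = e^{w_j} (j < r), y_r = e^{z₁+⋯+z_r - w₁ - ⋯ - w_{r-1}}  (nothing = index r)
yForm : ∀ {k} → Maybe (Fin k) → Form k
yForm (just j) (inj₁ i) = + 0
yForm (just j) (inj₂ i) = if does (Data.Fin._≟_ i j) then + 1 else + 0
yForm nothing  (inj₁ i) = + 1
yForm nothing  (inj₂ i) = ℤ.- (+ 1)

QSeries : ℕ → Set
QSeries k = ℕ → ExpPoly k

_*Q_ : ∀ {k} → QSeries k → QSeries k → QSeries k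
(f *Q g) N = concatMap (λ i → f i *E g (N ℕ.∸ i)) (range N)

oneQ : ∀ {k} → QSeries k
oneQ zero    = (1ℚ , 0F) ∷ []
oneQ (suc _) = []

prodQ : ∀ {k} → List (QSeries k) → QSeries k
prodQ = foldr _*Q_ oneQ

numFactor : ∀ {k} → Form k → ℕ → QSeries k
numFactor L n zero    = (1ℚ , 0F) ∷ []
numFactor L n (suc d) = if suc d ≡ᵇ n then (ℚ.- 1ℚ , L) ∷ [] else []

-- 1/(1 - y q^n) = Σ_{a ≥ 0} y^a q^{n a}, n ≥ 1
denFactor : ∀ {k} → Form k → ℕ → QSeries k
denFactor L zero    d = []
denFactor L (suc n) d =
  if does (suc n ∣? d) then (1ℚ , (d / suc n) •F L) ∷ [] else []

factorsUpTo : (k : ℕ) → ℕ → List (QSeries k)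
factorsUpTo k N = concatMap (λ n →
     map (λ j → numFactor (xForm j) n) (allFin (suc k))
  ++ map (λ j → denFactor (yForm (just j)) n) (allFin k)
  ++ denFactor (yForm nothing) n ∷ [])
  (range1 N)

-- Coefficient of q^N in Π_j (x_j q)_∞/(y_j q)_∞ (factors with n > N do not
-- contribute to q^N), as an element of ℚ[[z,w]] represented by ExpPoly.
prodCoeffQ : (k : ℕ) → ℕ → ExpPoly k
prodCoeffQ k N = prodQ (factorsUpTo k N) N

coeffZW : (k : ℕ) → (Vars k → ℕ) → Series
coeffZW k α N = coeffE α (prodCoeffQ k N)

totalDeg : (k : ℕ) → (Vars k → ℕ) → ℕ
totalDeg k α = sumℕ (map α (varList k))

-- Record a power series in z, w by its jet: the family of its iterated partial derivatives
-- at the origin, indexed by words in the variables; products of jets obey the Leibniz rule.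
-- Let T be the jet of the product. The factor (1 − x qⁿ)^{∓1} has logarithmic derivative
-- ±(∂ log x) Σ_{a ≥ 1} xᵃ q^{na}, so ∂_v T = T · H_v, where the u-th derivative of H_v at
-- the origin is C_v(u) Σ_N (Σ_{n d = N} d^{|u|}) qᴺ = C_v(u) |u|! [|u| + 1]. For u empty,
-- C_v vanishes because x₁ ⋯ x_r = y₁ ⋯ y_r; hence every derivative of order m of H_v has
-- weight m + 1. Since T is 1 at the origin, the Leibniz rule and induction on the order show
-- that derivatives of T of order m have weight m, and the coefficient of z^α w^β is such a
-- derivative divided by α! β!.
module Submission where

open import Defs
open import Algebra.Bundles using (CommutativeRing)
open import Data.Bool as Bool using (Bool; true; false; if_then_else_)
open import Data.Empty using (⊥-elim)
open import Data.Fin as Fin using (Fin)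
open import Data.Integer as ℤ using (ℤ; +_)
import Data.Integer.Properties as ℤP
open import Data.List as List using (List; []; _∷_; _++_; map; concatMap; applyUpTo; upTo; allFin; length; replicate)
import Data.List.Properties as ListP
open import Data.List.Relation.Unary.All as All using (All; []; _∷_)
import Data.List.Relation.Unary.All.Properties as AllP
open import Data.Maybe using (just; nothing)
open import Data.Nat as ℕ using (ℕ; zero; suc; _∸_; _≤_; _<_; z≤n; s≤s)
import Data.Nat.Properties as ℕP
open import Data.Nat.DivMod using (_/_; 0/n≡0; m/n≡1+[m∸n]/n; m*[n/m]≡n; m/n≤m)
open import Data.Nat.Divisibility using (_∣_; _∣?_; divides; _∣0; ∣⇒≤; ∣m∸n∣n⇒∣m; ∣m+n∣m⇒∣n; ∣-refl)
open import Data.Nat.ListAction using () renaming (sum to sumℕ)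
import Data.Nat.ListAction.Properties as ℕL
open import Data.Product using (_×_; _,_)
open import Data.Rational as ℚ using (ℚ; 0ℚ; 1ℚ)
import Data.Rational.Properties as ℚP
open import Data.Rational.Unnormalised as ℚᵘ using (mkℚᵘ; *≡*)
import Data.Rational.Unnormalised.Properties as ℚᵘP
open import Data.Sum using (inj₁; inj₂)
open import Data.Unit using (tt)
open import Relation.Binary.Bundles using (Setoid)
open import Relation.Binary.PropositionalEquality as ≡ using (_≡_; _≢_)
open import Relation.Nullary using (¬_; Dec; yes; no)
open import Relation.Nullary.Decidable using (does; dec-true; dec-false)

module PowerSeries {c ℓ} (R : CommutativeRing c ℓ) where

  open CommutativeRing R renaming (Carrier to A)
  open import Relation.Binary.Reasoning.Setoid setoid
  open import Algebra.Properties.CommutativeSemigroup +-commutativeSemigroup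
    using () renaming (interchange to +-interchange)

  ∑ : ℕ → (ℕ → A) → A
  ∑ zero    f = 0#
  ∑ (suc n) f = f 0 + ∑ n (λ i → f (suc i))

  ∑-cong : ∀ n {f g : ℕ → A} → (∀ i → i < n → f i ≈ g i) → ∑ n f ≈ ∑ n g
  ∑-cong zero    h = refl
  ∑-cong (suc n) h = +-cong (h 0 (s≤s z≤n)) (∑-cong n (λ i i<n → h (suc i) (s≤s i<n)))

  ∑-congᵢ : ∀ n {f g : ℕ → A} → (∀ i → f i ≈ g i) → ∑ n f ≈ ∑ n g
  ∑-congᵢ n h = ∑-cong n (λ i _ → h i)

  ∑-+ : ∀ n (f g : ℕ → A) → ∑ n (λ i → f i + g i) ≈ ∑ n f + ∑ n g
  ∑-+ zero    f g = sym (+-identityˡ 0#)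
  ∑-+ (suc n) f g = trans (+-congˡ (∑-+ n _ _)) (+-interchange _ _ _ _)

  *-∑ : ∀ n r (f : ℕ → A) → r * ∑ n f ≈ ∑ n (λ i → r * f i)
  *-∑ zero    r f = zeroʳ r
  *-∑ (suc n) r f = trans (distribˡ _ _ _) (+-congˡ (*-∑ n r _))

  ∑-* : ∀ n r (f : ℕ → A) → ∑ n f * r ≈ ∑ n (λ i → f i * r)
  ∑-* n r f = trans (*-comm _ _) (trans (*-∑ n r f) (∑-congᵢ n (λ i → *-comm r (f i))))

  ∑-zero : ∀ n (f : ℕ → A) → (∀ i → f i ≈ 0#) → ∑ n f ≈ 0#
  ∑-zero zero    f h = refl
  ∑-zero (suc n) f h = trans (+-cong (h 0) (∑-zero n _ (λ i → h (suc i)))) (+-identityˡ 0#)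

  ∑-last : ∀ n (f : ℕ → A) → ∑ (suc n) f ≈ ∑ n f + f n
  ∑-last zero    f = +-comm _ _
  ∑-last (suc n) f = trans (+-congˡ (∑-last n _)) (sym (+-assoc _ _ _))

  ∑-reverse : ∀ n (f : ℕ → A) → ∑ (suc n) f ≈ ∑ (suc n) (λ i → f (n ∸ i))
  ∑-reverse zero    f = refl
  ∑-reverse (suc n) f = begin
    f 0 + ∑ (suc n) (λ i → f (suc i))
      ≈⟨ +-congˡ (∑-reverse n (λ i → f (suc i))) ⟩
    f 0 + ∑ (suc n) (λ i → f (suc (n ∸ i)))
      ≈⟨ +-comm _ _ ⟩
    ∑ (suc n) (λ i → f (suc (n ∸ i))) + f 0
      ≈⟨ +-cong (∑-cong (suc n) shift) (reflexive (≡.cong f (≡.sym (ℕP.n∸n≡0 n)))) ⟩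
    ∑ (suc n) (λ i → f (suc n ∸ i)) + f (suc n ∸ suc n)
      ≈⟨ sym (∑-last (suc n) (λ i → f (suc n ∸ i))) ⟩
    ∑ (suc (suc n)) (λ i → f (suc n ∸ i)) ∎
    where
    shift : ∀ i → i < suc n → f (suc (n ∸ i)) ≈ f (suc n ∸ i)
    shift i i<n = reflexive (≡.cong f (≡.sym (ℕP.+-∸-assoc 1 (ℕP.≤-pred i<n))))

  ∑-single : ∀ n (f : ℕ → A) j → j < n → (∀ i → i ≢ j → f i ≈ 0#) → ∑ n f ≈ f j
  ∑-single (suc n) f zero    _         h =
    trans (+-congˡ (∑-zero n _ (λ i → h (suc i) (λ ())))) (+-identityʳ (f 0))
  ∑-single (suc n) f (suc j) (s≤s j<n) h =
    trans (+-congʳ (h 0 (λ ()))) (trans (+-identityˡ _)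
      (∑-single n (λ i → f (suc i)) j j<n (λ i i≢j → h (suc i) (λ e → i≢j (ℕP.suc-injective e)))))

  Seq : Set c
  Seq = ℕ → A

  infix 4 _≐_ _≐[_]_
  _≐_ : Seq → Seq → Set ℓ
  a ≐ b = ∀ N → a N ≈ b N

  _≐[_]_ : Seq → ℕ → Seq → Set ℓ
  a ≐[ M ] b = ∀ N → N ≤ M → a N ≈ b N

  ≐-setoid : Setoid c ℓ
  ≐-setoid = record
    { Carrier       = Seq
    ; _≈_           = _≐_
    ; isEquivalence = record
      { refl  = λ N → refl
      ; sym   = λ p N → sym (p N)
      ; trans = λ p q N → trans (p N) (q N) } }

  open Setoid ≐-setoid public using () renaming (refl to ≐-refl; sym to ≐-sym; trans to ≐-trans)

  infixl 7 _✶_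
  infixr 8 _·_
  infixl 6 _⊕_

  _⊕_ : Seq → Seq → Seq
  (a ⊕ b) N = a N + b N

  _·_ : A → Seq → Seq
  (r · a) N = r * a N

  𝟘 : Seq
  𝟘 N = 0#

  𝟙 : Seq
  𝟙 zero    = 1#
  𝟙 (suc _) = 0#

  _✶_ : Seq → Seq → Seq
  (a ✶ b) N = ∑ (suc N) (λ i → a i * b (N ∸ i))

  mono : ℕ → A → Seq
  mono zero    r zero    = r
  mono zero    r (suc N) = 0#
  mono (suc m) r zero    = 0#
  mono (suc m) r (suc N) = mono m r N

  ∏ˢ : List Seq → Seq
  ∏ˢ = List.foldr _✶_ 𝟙

  ∑ˢ : List Seq → Seq
  ∑ˢ = List.foldr _⊕_ 𝟘

  ⊕-cong : ∀ {a a' b b'} → a ≐ a' → b ≐ b' → a ⊕ b ≐ a' ⊕ b'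
  ⊕-cong p q N = +-cong (p N) (q N)

  ·-congˡ : ∀ r {a b} → a ≐ b → r · a ≐ r · b
  ·-congˡ r p N = *-congˡ (p N)

  ✶-cong : ∀ {a a' b b'} → a ≐ a' → b ≐ b' → a ✶ b ≐ a' ✶ b'
  ✶-cong p q N = ∑-congᵢ (suc N) (λ i → *-cong (p i) (q (N ∸ i)))

  ✶-congˡ : ∀ {a a'} b → a ≐ a' → a ✶ b ≐ a' ✶ b
  ✶-congˡ b p = ✶-cong p (≐-refl {b})

  ✶-congʳ : ∀ a {b b'} → b ≐ b' → a ✶ b ≐ a ✶ b'
  ✶-congʳ a = ✶-cong (≐-refl {a})

  ✶-comm : ∀ a b → a ✶ b ≐ b ✶ a
  ✶-comm a b N = begin
    ∑ (suc N) (λ i → a i * b (N ∸ i))               ≈⟨ ∑-reverse N (λ i → a i * b (N ∸ i)) ⟩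
    ∑ (suc N) (λ i → a (N ∸ i) * b (N ∸ (N ∸ i)))   ≈⟨ ∑-cong (suc N) swap ⟩
    ∑ (suc N) (λ i → b i * a (N ∸ i))               ∎
    where
    swap : ∀ i → i < suc N → a (N ∸ i) * b (N ∸ (N ∸ i)) ≈ b i * a (N ∸ i)
    swap i i<N = trans (*-comm _ _) (*-congʳ (reflexive (≡.cong b (ℕP.m∸[m∸n]≡n (ℕP.≤-pred i<N)))))

  ✶-distribˡ : ∀ d a b → d ✶ (a ⊕ b) ≐ d ✶ a ⊕ d ✶ b
  ✶-distribˡ d a b N =
    trans (∑-congᵢ (suc N) (λ i → distribˡ (d i) (a (N ∸ i)) (b (N ∸ i))))
          (∑-+ (suc N) (λ i → d i * a (N ∸ i)) (λ i → d i * b (N ∸ i)))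

  ✶-distribʳ : ∀ d a b → (a ⊕ b) ✶ d ≐ a ✶ d ⊕ b ✶ d
  ✶-distribʳ d a b N =
    trans (∑-congᵢ (suc N) (λ i → distribʳ (d (N ∸ i)) (a i) (b i)))
          (∑-+ (suc N) (λ i → a i * d (N ∸ i)) (λ i → b i * d (N ∸ i)))

  ·-✶ : ∀ r a b → (r · a) ✶ b ≐ r · (a ✶ b)
  ·-✶ r a b N = trans (∑-congᵢ (suc N) (λ i → *-assoc r (a i) (b (N ∸ i))))
                      (sym (*-∑ (suc N) r (λ i → a i * b (N ∸ i))))

  ✶-· : ∀ r a b → a ✶ (r · b) ≐ r · (a ✶ b)
  ✶-· r a b = ≐-trans (✶-comm a (r · b)) (≐-trans (·-✶ r b a) (·-congˡ r (✶-comm b a)))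

  ✶-assoc : ∀ a b d → (a ✶ b) ✶ d ≐ a ✶ (b ✶ d)
  ✶-assoc a b d zero = begin
    (a 0 * b 0 + 0#) * d 0 + 0#   ≈⟨ +-identityʳ _ ⟩
    (a 0 * b 0 + 0#) * d 0        ≈⟨ *-congʳ (+-identityʳ _) ⟩
    a 0 * b 0 * d 0               ≈⟨ *-assoc _ _ _ ⟩
    a 0 * (b 0 * d 0)             ≈⟨ *-congˡ (sym (+-identityʳ _)) ⟩
    a 0 * (b 0 * d 0 + 0#)        ≈⟨ sym (+-identityʳ _) ⟩
    a 0 * (b 0 * d 0 + 0#) + 0#   ∎
  ✶-assoc a b d (suc N) = begin
    (a ✶ b) 0 * d (suc N) + ((a ✶ b) ∘suc ✶ d) N
      ≈⟨ +-congʳ (*-congʳ (+-identityʳ _)) ⟩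
    a 0 * b 0 * d (suc N) + (((a 0 · b ∘suc) ⊕ (a ∘suc ✶ b)) ✶ d) N
      ≈⟨ +-congˡ (✶-distribʳ d (a 0 · b ∘suc) (a ∘suc ✶ b) N) ⟩
    a 0 * b 0 * d (suc N) + (((a 0 · b ∘suc) ✶ d) N + ((a ∘suc ✶ b) ✶ d) N)
      ≈⟨ +-congˡ (+-cong (·-✶ (a 0) (b ∘suc) d N) (✶-assoc (a ∘suc) b d N)) ⟩
    a 0 * b 0 * d (suc N) + (a 0 * (b ∘suc ✶ d) N + (a ∘suc ✶ (b ✶ d)) N)
      ≈⟨ sym (+-assoc _ _ _) ⟩
    (a 0 * b 0 * d (suc N) + a 0 * (b ∘suc ✶ d) N) + (a ∘suc ✶ (b ✶ d)) N
      ≈⟨ +-congʳ (trans (+-congʳ (*-assoc _ _ _)) (sym (distribˡ _ _ _))) ⟩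
    a 0 * (b 0 * d (suc N) + (b ∘suc ✶ d) N) + (a ∘suc ✶ (b ✶ d)) N ∎
    where
    _∘suc : Seq → Seq
    (s ∘suc) n = s (suc n)

  ✶-lcomm : ∀ a b d → a ✶ (b ✶ d) ≐ b ✶ (a ✶ d)
  ✶-lcomm a b d =
    ≐-trans (≐-sym (✶-assoc a b d)) (≐-trans (✶-congˡ d (✶-comm a b)) (✶-assoc b a d))

  ✶-identityˡ : ∀ a → 𝟙 ✶ a ≐ a
  ✶-identityˡ a N =
    trans (+-cong (*-identityˡ _) (∑-zero N _ (λ i → zeroˡ (a (N ∸ suc i))))) (+-identityʳ _)

  ✶-identityʳ : ∀ a → a ✶ 𝟙 ≐ a
  ✶-identityʳ a = ≐-trans (✶-comm a 𝟙) (✶-identityˡ a)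

  ✶-zeroˡ : ∀ a → 𝟘 ✶ a ≐ 𝟘
  ✶-zeroˡ a N = ∑-zero (suc N) _ (λ i → zeroˡ (a (N ∸ i)))

  ✶-zeroʳ : ∀ a → a ✶ 𝟘 ≐ 𝟘
  ✶-zeroʳ a = ≐-trans (✶-comm a 𝟘) (✶-zeroˡ a)

  mono-✶-≥ : ∀ m r a N → m ≤ N → (mono m r ✶ a) N ≈ r * a (N ∸ m)
  mono-✶-≥ zero    r a N       _         =
    trans (+-congˡ (∑-zero N _ (λ i → zeroˡ (a (N ∸ suc i))))) (+-identityʳ _)
  mono-✶-≥ (suc m) r a (suc N) (s≤s m≤N) =
    trans (trans (+-congʳ (zeroˡ _)) (+-identityˡ _)) (mono-✶-≥ m r a N m≤N)

  mono-✶-< : ∀ m r a N → N < m → (mono m r ✶ a) N ≈ 0#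
  mono-✶-< (suc m) r a zero    _         = trans (+-congʳ (zeroˡ _)) (+-identityˡ _)
  mono-✶-< (suc m) r a (suc N) (s≤s N<m) =
    trans (trans (+-congʳ (zeroˡ _)) (+-identityˡ _)) (mono-✶-< m r a N N<m)

  mono-< : ∀ m r N → N < m → mono m r N ≈ 0#
  mono-< (suc m) r zero    _       = refl
  mono-< (suc m) r (suc N) (s≤s h) = mono-< m r N h

  mono-≡ᵇ : ∀ m r N → mono m r N ≡ (if N ℕ.≡ᵇ m then r else 0#)
  mono-≡ᵇ zero    r zero    = ≡.refl
  mono-≡ᵇ zero    r (suc N) = ≡.refl
  mono-≡ᵇ (suc m) r zero    = ≡.refl
  mono-≡ᵇ (suc m) r (suc N) = mono-≡ᵇ m r N

  mono-cong : ∀ m {x y} → x ≈ y → mono m x ≐ mono m y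
  mono-cong zero    p zero    = p
  mono-cong zero    p (suc N) = refl
  mono-cong (suc m) p zero    = refl
  mono-cong (suc m) p (suc N) = mono-cong m p N

  mono-* : ∀ m r x → mono m (r * x) ≐ r · mono m x
  mono-* zero    r x zero    = refl
  mono-* zero    r x (suc N) = sym (zeroʳ r)
  mono-* (suc m) r x zero    = sym (zeroʳ r)
  mono-* (suc m) r x (suc N) = mono-* m r x N

  mono-0# : ∀ m → mono m 0# ≐ 𝟘
  mono-0# zero    zero    = refl
  mono-0# zero    (suc N) = refl
  mono-0# (suc m) zero    = refl
  mono-0# (suc m) (suc N) = mono-0# m N

  mono-0-1 : mono 0 1# ≐ 𝟙
  mono-0-1 zero    = refl
  mono-0-1 (suc N) = refl

  ∏ˢ-++ : ∀ xs ys → ∏ˢ (xs ++ ys) ≐ ∏ˢ xs ✶ ∏ˢ ys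
  ∏ˢ-++ []       ys = ≐-sym (✶-identityˡ _)
  ∏ˢ-++ (x ∷ xs) ys = ≐-trans (✶-congʳ x (∏ˢ-++ xs ys)) (≐-sym (✶-assoc x _ _))

  ∑ˢ-++ : ∀ xs ys → ∑ˢ (xs ++ ys) ≐ ∑ˢ xs ⊕ ∑ˢ ys
  ∑ˢ-++ []       ys N = sym (+-identityˡ _)
  ∑ˢ-++ (x ∷ xs) ys N = trans (+-congˡ (∑ˢ-++ xs ys N)) (sym (+-assoc _ _ _))

  ∏ˢ-move : ∀ xs y ys → ∏ˢ (xs ++ y ∷ ys) ≐ y ✶ ∏ˢ (xs ++ ys)
  ∏ˢ-move []       y ys = ≐-refl
  ∏ˢ-move (x ∷ xs) y ys = ≐-trans (✶-congʳ x (∏ˢ-move xs y ys)) (✶-lcomm x y _)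

  ∏ˢ-inverse-pairs : ∀ a b → a ✶ b ≐ 𝟙 → ∀ xs ys → length xs ≡ length ys →
                     All (_≐ a) xs → All (_≐ b) ys → ∏ˢ (xs ++ ys) ≐ 𝟙
  ∏ˢ-inverse-pairs a b ab [] [] _ [] [] = ≐-refl
  ∏ˢ-inverse-pairs a b ab (x ∷ xs) (y ∷ ys) eq (px ∷ pxs) (py ∷ pys) =
    ≐-trans (✶-congʳ x (∏ˢ-move xs y ys))
    (≐-trans (≐-sym (✶-assoc x y _))
    (≐-trans (✶-cong (≐-trans (✶-cong px py) ab)
                     (∏ˢ-inverse-pairs a b ab xs ys (ℕP.suc-injective eq) pxs pys))
             (✶-identityˡ 𝟙)))

  ≐[]-refl : ∀ {M a} → a ≐[ M ] a
  ≐[]-refl _ _ = refl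

  ≐[]-trans : ∀ {M a b d} → a ≐[ M ] b → b ≐[ M ] d → a ≐[ M ] d
  ≐[]-trans p q i h = trans (p i h) (q i h)

  ≐[]-weaken : ∀ {N M a b} → N ≤ M → a ≐[ M ] b → a ≐[ N ] b
  ≐[]-weaken N≤M p i i≤N = p i (ℕP.≤-trans i≤N N≤M)

  ≐⇒≐[] : ∀ {M a b} → a ≐ b → a ≐[ M ] b
  ≐⇒≐[] p i _ = p i

  ✶-cong[] : ∀ {M a a' b b'} → a ≐[ M ] a' → b ≐[ M ] b' → a ✶ b ≐[ M ] a' ✶ b'
  ✶-cong[] {M} p q N N≤M = ∑-cong (suc N) (λ i i≤N →
    *-cong (p i (ℕP.≤-trans (ℕP.≤-pred i≤N) N≤M)) (q (N ∸ i) (ℕP.≤-trans (ℕP.m∸n≤m N i) N≤M)))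

  ∏ˢ-≐[]-𝟙 : ∀ {M} xs → All (_≐[ M ] 𝟙) xs → ∏ˢ xs ≐[ M ] 𝟙
  ∏ˢ-≐[]-𝟙 []       []         = ≐[]-refl
  ∏ˢ-≐[]-𝟙 (x ∷ xs) (px ∷ pxs) =
    ≐[]-trans (✶-cong[] px (∏ˢ-≐[]-𝟙 xs pxs)) (≐⇒≐[] (✶-identityˡ 𝟙))

  ∑ˢ-≐[]-𝟘 : ∀ {M} xs → All (_≐[ M ] 𝟘) xs → ∑ˢ xs ≐[ M ] 𝟘
  ∑ˢ-≐[]-𝟘 []       []         = ≐[]-refl
  ∑ˢ-≐[]-𝟘 (x ∷ xs) (px ∷ pxs) i h = trans (+-cong (px i h) (∑ˢ-≐[]-𝟘 xs pxs i h)) (+-identityˡ 0#)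

  stabilises : (X : ℕ → Seq) → (∀ M → X (suc M) ≐[ M ] X M) → ∀ {N M} → N ≤ M → X M ≐[ N ] X N
  stabilises X step {N} {M} N≤M =
    ≡.subst (λ z → X z ≐[ N ] X N) (ℕP.m∸n+n≡m N≤M) (go (M ∸ N))
    where
    go : ∀ d → X (d ℕ.+ N) ≐[ N ] X N
    go zero    = ≐[]-refl
    go (suc d) = ≐[]-trans (≐[]-weaken (ℕP.m≤n+m N d) (step (d ℕ.+ N))) (go d)

-- F w = ∂_w f(0) for a power series f in the variables V, and _⊛_ is the Leibniz rule.
module Jets {c ℓ} (R : CommutativeRing c ℓ) (V : Set) where

  open CommutativeRing R renaming (Carrier to A)
  open import Relation.Binary.Reasoning.Setoid setoid
  open import Algebra.Properties.CommutativeSemigroup +-commutativeSemigroup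
    using () renaming (interchange to +-interchange)

  Word : Set
  Word = List V

  Jet : Set c
  Jet = Word → A

  infix  4 _≗_
  infixl 6 _+ʲ_
  infixl 7 _⊛_
  infixr 8 _⋅_

  _≗_ : Jet → Jet → Set ℓ
  F ≗ G = ∀ w → F w ≈ G w

  _+ʲ_ : Jet → Jet → Jet
  (F +ʲ G) w = F w + G w

  -ʲ_ : Jet → Jet
  (-ʲ F) w = - F w

  0ʲ : Jet
  0ʲ w = 0#

  1ʲ : Jet
  1ʲ []      = 1#
  1ʲ (_ ∷ _) = 0#

  _⋅_ : A → Jet → Jet
  (r ⋅ F) w = r * F w

  ∂ : V → Jet → Jet
  ∂ v F w = F (v ∷ w)

  _⊛_ : Jet → Jet → Jet
  (F ⊛ G) []      = F [] * G []
  (F ⊛ G) (v ∷ w) = (∂ v F ⊛ G) w + (F ⊛ ∂ v G) w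

  ⊛-cong : ∀ {F F' G G'} → F ≗ F' → G ≗ G' → F ⊛ G ≗ F' ⊛ G'
  ⊛-cong p q []      = *-cong (p []) (q [])
  ⊛-cong p q (v ∷ w) = +-cong (⊛-cong (λ u → p (v ∷ u)) q w) (⊛-cong p (λ u → q (v ∷ u)) w)

  ⊛-comm : ∀ F G → F ⊛ G ≗ G ⊛ F
  ⊛-comm F G []      = *-comm (F []) (G [])
  ⊛-comm F G (v ∷ w) = trans (+-cong (⊛-comm (∂ v F) G w) (⊛-comm F (∂ v G) w)) (+-comm _ _)

  ⊛-distribˡ : ∀ F G H → F ⊛ (G +ʲ H) ≗ F ⊛ G +ʲ F ⊛ H
  ⊛-distribˡ F G H []      = distribˡ (F []) (G []) (H [])
  ⊛-distribˡ F G H (v ∷ w) =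
    trans (+-cong (⊛-distribˡ (∂ v F) G H w) (⊛-distribˡ F (∂ v G) (∂ v H) w)) (+-interchange _ _ _ _)

  ⊛-distribʳ : ∀ F G H → (G +ʲ H) ⊛ F ≗ G ⊛ F +ʲ H ⊛ F
  ⊛-distribʳ F G H w =
    trans (⊛-comm (G +ʲ H) F w) (trans (⊛-distribˡ F G H w) (+-cong (⊛-comm F G w) (⊛-comm F H w)))

  ⋅-⊛ : ∀ r F G → (r ⋅ F) ⊛ G ≗ r ⋅ (F ⊛ G)
  ⋅-⊛ r F G []      = *-assoc r (F []) (G [])
  ⋅-⊛ r F G (v ∷ w) = trans (+-cong (⋅-⊛ r (∂ v F) G w) (⋅-⊛ r F (∂ v G) w)) (sym (distribˡ r _ _))

  ⊛-⋅ : ∀ r F G → F ⊛ (r ⋅ G) ≗ r ⋅ (F ⊛ G)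
  ⊛-⋅ r F G w = trans (⊛-comm F (r ⋅ G) w) (trans (⋅-⊛ r G F w) (*-congˡ (⊛-comm G F w)))

  ⊛-zeroˡ : ∀ F → 0ʲ ⊛ F ≗ 0ʲ
  ⊛-zeroˡ F []      = zeroˡ (F [])
  ⊛-zeroˡ F (v ∷ w) = trans (+-cong (⊛-zeroˡ F w) (⊛-zeroˡ (∂ v F) w)) (+-identityˡ 0#)

  ⊛-identityˡ : ∀ F → 1ʲ ⊛ F ≗ F
  ⊛-identityˡ F []      = *-identityˡ (F [])
  ⊛-identityˡ F (v ∷ w) = trans (+-cong (⊛-zeroˡ F w) (⊛-identityˡ (∂ v F) w)) (+-identityˡ _)

  ⊛-assoc : ∀ F G H → (F ⊛ G) ⊛ H ≗ F ⊛ (G ⊛ H)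
  ⊛-assoc F G H []      = *-assoc (F []) (G []) (H [])
  ⊛-assoc F G H (v ∷ w) = begin
    (∂ v (F ⊛ G) ⊛ H) w + ((F ⊛ G) ⊛ ∂ v H) w
      ≈⟨ +-congʳ (⊛-distribʳ H (∂ v F ⊛ G) (F ⊛ ∂ v G) w) ⟩
    ((∂ v F ⊛ G) ⊛ H) w + ((F ⊛ ∂ v G) ⊛ H) w + ((F ⊛ G) ⊛ ∂ v H) w
      ≈⟨ +-cong (+-cong (⊛-assoc (∂ v F) G H w) (⊛-assoc F (∂ v G) H w)) (⊛-assoc F G (∂ v H) w) ⟩
    (∂ v F ⊛ (G ⊛ H)) w + (F ⊛ (∂ v G ⊛ H)) w + (F ⊛ (G ⊛ ∂ v H)) w
      ≈⟨ +-assoc _ _ _ ⟩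
    (∂ v F ⊛ (G ⊛ H)) w + ((F ⊛ (∂ v G ⊛ H)) w + (F ⊛ (G ⊛ ∂ v H)) w)
      ≈⟨ +-congˡ (sym (⊛-distribˡ F (∂ v G ⊛ H) (G ⊛ ∂ v H) w)) ⟩
    (∂ v F ⊛ (G ⊛ H)) w + (F ⊛ ∂ v (G ⊛ H)) w ∎

  jetRing : CommutativeRing c ℓ
  jetRing = record
    { Carrier = Jet ; _≈_ = _≗_ ; _+_ = _+ʲ_ ; _*_ = _⊛_ ; -_ = -ʲ_ ; 0# = 0ʲ ; 1# = 1ʲ
    ; isCommutativeRing = record
      { isRing = record
        { +-isAbelianGroup = record
          { isGroup = record
            { isMonoid = record
              { isSemigroup = record
                { isMagma = record
                  { isEquivalence = record
                    { refl = λ w → refl ; sym = λ p w → sym (p w) ; trans = λ p q w → trans (p w) (q w) }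
                  ; ∙-cong = λ p q w → +-cong (p w) (q w) }
                ; assoc = λ F G H w → +-assoc (F w) (G w) (H w) }
              ; identity = (λ F w → +-identityˡ (F w)) , (λ F w → +-identityʳ (F w)) }
            ; inverse = (λ F w → -‿inverseˡ (F w)) , (λ F w → -‿inverseʳ (F w))
            ; ⁻¹-cong = λ p w → -‿cong (p w) }
          ; comm = λ F G w → +-comm (F w) (G w) }
        ; *-cong = ⊛-cong
        ; *-assoc = ⊛-assoc
        ; *-identity = ⊛-identityˡ , (λ F w → trans (⊛-comm F 1ʲ w) (⊛-identityˡ F w))
        ; distrib = ⊛-distribˡ , ⊛-distribʳ }
      ; *-comm = ⊛-comm } }

open ≡ hiding (_≗_)
open import Algebra.Properties.Group ℚP.+-0-group using (inverseʳ-unique; ⁻¹-involutive)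

ℚ-ring : CommutativeRing _ _
ℚ-ring = ℚP.+-*-commutativeRing

module QS = PowerSeries ℚ-ring

open import Algebra.Properties.CommutativeSemigroup (CommutativeRing.*-commutativeSemigroup ℚ-ring)
  using () renaming (interchange to ℚ-*-interchange)

ι : ℤ → ℚ
ι z = z ℚ./ 1

-- ι is computed through the unnormalised rationals, where z / 1 is literally mkℚᵘ z 0.
ι-+ : ∀ a b → ι (a ℤ.+ b) ≡ ι a ℚ.+ ι b
ι-+ a b = ℚP.toℚᵘ-injective (ℚᵘP.≃-trans (ℚP.toℚᵘ-fromℚᵘ (mkℚᵘ (a ℤ.+ b) 0))
  (ℚᵘP.≃-trans unnormalised (ℚᵘP.≃-sym (ℚᵘP.≃-trans (ℚP.toℚᵘ-homo-+ (ι a) (ι b))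
    (ℚᵘP.+-cong (ℚP.toℚᵘ-fromℚᵘ (mkℚᵘ a 0)) (ℚP.toℚᵘ-fromℚᵘ (mkℚᵘ b 0)))))))
  where
  unnormalised : mkℚᵘ (a ℤ.+ b) 0 ℚᵘ.≃ (mkℚᵘ a 0 ℚᵘ.+ mkℚᵘ b 0)
  unnormalised = *≡* (trans (ℤP.*-identityʳ _)
    (sym (trans (ℤP.*-identityʳ _) (cong₂ ℤ._+_ (ℤP.*-identityʳ a) (ℤP.*-identityʳ b)))))

ι-* : ∀ a b → ι (a ℤ.* b) ≡ ι a ℚ.* ι b
ι-* a b = ℚP.toℚᵘ-injective (ℚᵘP.≃-trans (ℚP.toℚᵘ-fromℚᵘ (mkℚᵘ (a ℤ.* b) 0))
  (ℚᵘP.≃-trans (*≡* refl) (ℚᵘP.≃-sym (ℚᵘP.≃-trans (ℚP.toℚᵘ-homo-* (ι a) (ι b))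
    (ℚᵘP.*-cong (ℚP.toℚᵘ-fromℚᵘ (mkℚᵘ a 0)) (ℚP.toℚᵘ-fromℚᵘ (mkℚᵘ b 0)))))))

ιℕ : ℕ → ℚ
ιℕ n = ι (+ n)

ιℕ-+ : ∀ m n → ιℕ (m ℕ.+ n) ≡ ιℕ m ℚ.+ ιℕ n
ιℕ-+ m n = trans (cong ι (ℤP.pos-+ m n)) (ι-+ (+ m) (+ n))

ιℕ-* : ∀ m n → ιℕ (m ℕ.* n) ≡ ιℕ m ℚ.* ιℕ n
ιℕ-* m n = trans (cong ι (ℤP.pos-* m n)) (ι-* (+ m) (+ n))

ιℕ-^ : ∀ a p → ιℕ (a ℕ.^ p) ≡ ιℕ a ^ℚ p
ιℕ-^ a zero    = refl
ιℕ-^ a (suc p) = trans (ιℕ-* a (a ℕ.^ p)) (cong (ιℕ a ℚ.*_) (ιℕ-^ a p))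

ιℕ-*-inverse : ∀ n .{{_ : ℕ.NonZero n}} → ιℕ n ℚ.* ((+ 1) ℚ./ n) ≡ 1ℚ
ιℕ-*-inverse (suc r) = ℚP.toℚᵘ-injective (ℚᵘP.≃-trans (ℚP.toℚᵘ-homo-* (ιℕ (suc r)) ((+ 1) ℚ./ suc r))
  (ℚᵘP.≃-trans (ℚᵘP.*-cong (ℚP.toℚᵘ-fromℚᵘ (mkℚᵘ (+ suc r) 0)) (ℚP.toℚᵘ-fromℚᵘ (mkℚᵘ (+ 1) r)))
    (ℚᵘP.*-inverseʳ (mkℚᵘ (+ suc r) 0))))

ιℕ-!-*-inv! : ∀ p → ιℕ (p ℕ.!) ℚ.* inv! p ≡ 1ℚ
ιℕ-!-*-inv! p = ιℕ-*-inverse (p ℕ.!) {{p ℕP.!≢0}}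

ιℕ-sum : ∀ (F : ℕ → ℕ) n (f : ℕ → ℕ) →
         ιℕ (sumℕ (map F (map suc (applyUpTo f n)))) ≡ QS.∑ n (λ i → ιℕ (F (suc (f i))))
ιℕ-sum F zero    f = refl
ιℕ-sum F (suc n) f = trans (ιℕ-+ (F (suc (f 0))) _) (cong (ιℕ (F (suc (f 0))) ℚ.+_) (ιℕ-sum F n (λ i → f (suc i))))

sumℚ-++ : ∀ xs ys → sumℚ (xs ++ ys) ≡ sumℚ xs ℚ.+ sumℚ ys
sumℚ-++ []       ys = sym (ℚP.+-identityˡ _)
sumℚ-++ (x ∷ xs) ys = trans (cong (x ℚ.+_) (sumℚ-++ xs ys)) (sym (ℚP.+-assoc x (sumℚ xs) (sumℚ ys)))

sumℚ-*ˡ : ∀ {A : Set} c (f : A → ℚ) xs → sumℚ (map (λ x → c ℚ.* f x) xs) ≡ c ℚ.* sumℚ (map f xs)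
sumℚ-*ˡ c f []       = sym (ℚP.*-zeroʳ c)
sumℚ-*ˡ c f (x ∷ xs) = trans (cong (c ℚ.* f x ℚ.+_) (sumℚ-*ˡ c f xs)) (sym (ℚP.*-distribˡ-+ c (f x) _))

sumℚ-map-++ : ∀ {A : Set} (f : A → ℚ) xs ys → sumℚ (map f (xs ++ ys)) ≡ sumℚ (map f xs) ℚ.+ sumℚ (map f ys)
sumℚ-map-++ f xs ys = trans (cong sumℚ (ListP.map-++ f xs ys)) (sumℚ-++ (map f xs) (map f ys))

sumℚ-tabulate-0 : ∀ n (h : Fin n → ℚ) → (∀ j → h j ≡ 0ℚ) → sumℚ (List.tabulate h) ≡ 0ℚ
sumℚ-tabulate-0 zero    h h≡0 = refl
sumℚ-tabulate-0 (suc n) h h≡0 =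
  cong₂ ℚ._+_ (h≡0 Fin.zero) (sumℚ-tabulate-0 n (λ j → h (Fin.suc j)) (λ j → h≡0 (Fin.suc j)))

sumℚ-allFin-0 : ∀ n (h : Fin n → ℚ) → (∀ j → h j ≡ 0ℚ) → sumℚ (map h (allFin n)) ≡ 0ℚ
sumℚ-allFin-0 n h h≡0 = trans (cong sumℚ (ListP.map-tabulate (λ j → j) h)) (sumℚ-tabulate-0 n h h≡0)

sumℚ-allFin-indicator : ∀ n (i : Fin n) (f : ℤ → ℚ) → f (+ 0) ≡ 0ℚ →
  sumℚ (map (λ j → f (if does (i Fin.≟ j) then + 1 else + 0)) (allFin n)) ≡ f (+ 1)
sumℚ-allFin-indicator n i f f0 =
  trans (cong sumℚ (ListP.map-tabulate (λ j → j) (λ j → f (if does (i Fin.≟ j) then + 1 else + 0)))) (go n i)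
  where
  go : ∀ n (i : Fin n) → sumℚ (List.tabulate (λ j → f (if does (i Fin.≟ j) then + 1 else + 0))) ≡ f (+ 1)
  go (suc n) Fin.zero    = trans (cong (f (+ 1) ℚ.+_) (sumℚ-tabulate-0 n _ (λ j → f0))) (ℚP.+-identityʳ (f (+ 1)))
  go (suc n) (Fin.suc i) = trans (cong₂ ℚ._+_ f0 (go n i)) (ℚP.+-identityˡ (f (+ 1)))

*S≗✶ : ∀ (f g : Series) N → (f *S g) N ≡ (f QS.✶ g) N
*S≗✶ f g N = go (suc N) (λ i → i)
  where
  go : ∀ n (h : ℕ → ℕ) → sumℚ (map (λ i → f i ℚ.* g (N ∸ i)) (applyUpTo h n))
                       ≡ QS.∑ n (λ i → f (h i) ℚ.* g (N ∸ h i))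
  go zero    h = refl
  go (suc n) h = cong (f (h 0) ℚ.* g (N ∸ h 0) ℚ.+_) (go n (λ i → h (suc i)))

prodS≗∏ˢ : ∀ xs → prodS xs QS.≐ QS.∏ˢ xs
prodS≗∏ˢ []       zero    = refl
prodS≗∏ˢ []       (suc N) = refl
prodS≗∏ˢ (x ∷ xs) N       = trans (*S≗✶ x (prodS xs) N) (QS.✶-congʳ x (prodS≗∏ˢ xs) N)

termsSeries : List Term → Series
termsSeries ts N = sumℚ (map (λ t → termSeries t N) ts)

termsSeries-++ : ∀ ts us N → termsSeries (ts ++ us) N ≡ termsSeries ts N ℚ.+ termsSeries us N
termsSeries-++ []       us N = sym (ℚP.+-identityˡ _)
termsSeries-++ (t ∷ ts) us N =
  trans (cong (termSeries t N ℚ.+_) (termsSeries-++ ts us N)) (sym (ℚP.+-assoc (termSeries t N) _ _))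

-- Weights of q-series

HasWeight-resp : ∀ {w f g} → f QS.≐ g → HasWeight w f → HasWeight w g
HasWeight-resp f≐g (ts , ok , eq) = ts , ok , (λ N → trans (eq N) (f≐g N))

HasWeight-cast : ∀ {w w' f} → w ≡ w' → HasWeight w f → HasWeight w' f
HasWeight-cast refl h = h

HasWeight-𝟘 : ∀ w → HasWeight w QS.𝟘
HasWeight-𝟘 w = [] , [] , (λ N → refl)

HasWeight-oneS : HasWeight 0 oneS
HasWeight-oneS = (1ℚ , []) ∷ [] , ([] , refl) ∷ [] , (λ N → trans (ℚP.+-identityʳ _) (ℚP.*-identityˡ (oneS N)))

HasWeight-+ : ∀ {w f g} → HasWeight w f → HasWeight w g → HasWeight w (f QS.⊕ g)
HasWeight-+ (ts , okt , eqt) (us , oku , equ) =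
  ts ++ us , AllP.++⁺ okt oku , (λ N → trans (termsSeries-++ ts us N) (cong₂ ℚ._+_ (eqt N) (equ N)))

HasWeight-· : ∀ {w f} c → HasWeight w f → HasWeight w (c QS.· f)
HasWeight-· {w} c (ts , ok , eq) = map scale ts , scale-ok ts ok , (λ N → trans (scale-eq ts N) (cong (c ℚ.*_) (eq N)))
  where
  scale : Term → Term
  scale (c' , bs) = (c ℚ.* c' , bs)
  scale-ok : ∀ ts → All (TermOk w) ts → All (TermOk w) (map scale ts)
  scale-ok []       []       = []
  scale-ok (t ∷ ts) (p ∷ ps) = p ∷ scale-ok ts ps
  scale-eq : ∀ ts N → termsSeries (map scale ts) N ≡ c ℚ.* termsSeries ts N
  scale-eq []              N = sym (ℚP.*-zeroʳ c)
  scale-eq ((c' , bs) ∷ ts) N =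
    trans (cong₂ ℚ._+_ (ℚP.*-assoc c c' _) (scale-eq ts N)) (sym (ℚP.*-distribˡ-+ c _ _))

_*T_ : Term → Term → Term
(c , bs) *T (d , cs) = (c ℚ.* d , bs ++ cs)

*T-ok : ∀ {a b} t u → TermOk a t → TermOk b u → TermOk (a ℕ.+ b) (t *T u)
*T-ok (c , bs) (d , cs) (pb , wb) (pc , wc) = AllP.++⁺ pb pc ,
  trans (cong sumℕ (ListP.map-++ sumℕ bs cs)) (trans (ℕL.sum-++ (map sumℕ bs) (map sumℕ cs)) (cong₂ ℕ._+_ wb wc))

*T-series : ∀ t u → termSeries (t *T u) QS.≐ termSeries t QS.✶ termSeries u
*T-series (c , bs) (d , cs) N = begin
  c ℚ.* d ℚ.* prodS (map bracket (bs ++ cs)) N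
    ≡⟨ cong (λ xs → c ℚ.* d ℚ.* prodS xs N) (ListP.map-++ bracket bs cs) ⟩
  c ℚ.* d ℚ.* prodS (B ++ C) N
    ≡⟨ cong (c ℚ.* d ℚ.*_) (trans (prodS≗∏ˢ (B ++ C) N) (QS.∏ˢ-++ B C N)) ⟩
  c ℚ.* d ℚ.* (QS.∏ˢ B QS.✶ QS.∏ˢ C) N
    ≡⟨ trans (ℚP.*-assoc c d _) (cong (c ℚ.*_) (sym (QS.✶-· d (QS.∏ˢ B) (QS.∏ˢ C) N))) ⟩
  c ℚ.* (QS.∏ˢ B QS.✶ d QS.· QS.∏ˢ C) N
    ≡⟨ sym (QS.·-✶ c (QS.∏ˢ B) (d QS.· QS.∏ˢ C) N) ⟩
  (c QS.· QS.∏ˢ B QS.✶ d QS.· QS.∏ˢ C) N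
    ≡⟨ QS.✶-cong (QS.·-congˡ c (QS.≐-sym (prodS≗∏ˢ B))) (QS.·-congˡ d (QS.≐-sym (prodS≗∏ˢ C))) N ⟩
  (termSeries (c , bs) QS.✶ termSeries (d , cs)) N ∎
  where
  open ≡-Reasoning
  B = map bracket bs
  C = map bracket cs

_*Ts_ : List Term → List Term → List Term
ts *Ts us = concatMap (λ t → map (t *T_) us) ts

*Ts-ok : ∀ {a b} ts us → All (TermOk a) ts → All (TermOk b) us → All (TermOk (a ℕ.+ b)) (ts *Ts us)
*Ts-ok []       us []       _  = []
*Ts-ok (t ∷ ts) us (p ∷ ps) qs = AllP.++⁺ (row us qs) (*Ts-ok ts us ps qs)
  where
  row : ∀ us → All (TermOk _) us → All (TermOk _) (map (t *T_) us)
  row []       []       = []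
  row (u ∷ us) (q ∷ qs) = *T-ok t u p q ∷ row us qs

*Ts-series : ∀ ts us → termsSeries (ts *Ts us) QS.≐ termsSeries ts QS.✶ termsSeries us
*Ts-series []       us N = sym (QS.✶-zeroˡ (termsSeries us) N)
*Ts-series (t ∷ ts) us N = begin
  termsSeries (map (t *T_) us ++ ts *Ts us) N
    ≡⟨ termsSeries-++ (map (t *T_) us) (ts *Ts us) N ⟩
  termsSeries (map (t *T_) us) N ℚ.+ termsSeries (ts *Ts us) N
    ≡⟨ cong₂ ℚ._+_ (row us N) (*Ts-series ts us N) ⟩
  (termSeries t QS.✶ termsSeries us) N ℚ.+ (termsSeries ts QS.✶ termsSeries us) N
    ≡⟨ sym (QS.✶-distribʳ (termsSeries us) (termSeries t) (termsSeries ts) N) ⟩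
  (termsSeries (t ∷ ts) QS.✶ termsSeries us) N ∎
  where
  open ≡-Reasoning
  row : ∀ us → termsSeries (map (t *T_) us) QS.≐ termSeries t QS.✶ termsSeries us
  row []       N = sym (QS.✶-zeroʳ (termSeries t) N)
  row (u ∷ us) N = trans (cong₂ ℚ._+_ (*T-series t u N) (row us N))
                         (sym (QS.✶-distribˡ (termSeries t) (termSeries u) (termsSeries us) N))

HasWeight-✶ : ∀ {a b f g} → HasWeight a f → HasWeight b g → HasWeight (a ℕ.+ b) (f QS.✶ g)
HasWeight-✶ (ts , okt , eqt) (us , oku , equ) =
  ts *Ts us , *Ts-ok ts us okt oku , QS.≐-trans (*Ts-series ts us) (QS.✶-cong eqt equ)

-- The (n, d) summand of bracketCount (suc p ∷ []) _ N.
divisorTerm : ℕ → ℕ → ℕ → ℕ → ℕ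
divisorTerm n N p d =
  if n ℕ.* d ℕ.≤ᵇ N then d ℕ.^ p ℕ.* (if N ∸ n ℕ.* d ℕ.≡ᵇ 0 then 1 else 0) else 0

divisorSum : ℕ → ℕ → ℕ → ℕ
divisorSum n N p = sumℕ (map (divisorTerm n N p) (range1 N))

divisorTerm-≡ : ∀ n N p d → n ℕ.* d ≡ N → divisorTerm n N p d ≡ d ℕ.^ p
divisorTerm-≡ n N p d nd≡N with n ℕ.* d ℕ.≤ᵇ N in le
... | true rewrite nd≡N | ℕP.n∸n≡0 N = ℕP.*-identityʳ (d ℕ.^ p)
... | false = ⊥-elim (subst Bool.T le (ℕP.≤⇒≤ᵇ (ℕP.≤-reflexive nd≡N)))

divisorTerm-≢ : ∀ n N p d → n ℕ.* d ≢ N → divisorTerm n N p d ≡ 0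
divisorTerm-≢ n N p d nd≢N with n ℕ.* d ℕ.≤ᵇ N in le
... | false = refl
... | true with N ∸ n ℕ.* d ℕ.≡ᵇ 0 in eq
...   | false = ℕP.*-zeroʳ (d ℕ.^ p)
...   | true  = ⊥-elim (nd≢N (ℕP.≤-antisym (ℕP.≤ᵇ⇒≤ (n ℕ.* d) N (subst Bool.T (sym le) tt))
                                 (ℕP.m∸n≡0⇒m≤n (ℕP.≡ᵇ⇒≡ (N ∸ n ℕ.* d) 0 (subst Bool.T (sym eq) tt)))))

divisorSum-∤ : ∀ n N p → (∀ d → 1 ≤ d → n ℕ.* d ≢ N) → ιℕ (divisorSum n N p) ≡ 0ℚ
divisorSum-∤ n N p h = trans (ιℕ-sum (divisorTerm n N p) N (λ i → i))
  (QS.∑-zero N _ (λ i → cong ιℕ (divisorTerm-≢ n N p (suc i) (h (suc i) (s≤s z≤n)))))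

divisorSum-∣ : ∀ m N p d → suc m ℕ.* d ≡ N → 1 ≤ d → d ≤ N → ιℕ (divisorSum (suc m) N p) ≡ ιℕ (d ℕ.^ p)
divisorSum-∣ m N p (suc j) nd≡N _ d≤N = trans (ιℕ-sum (divisorTerm (suc m) N p) N (λ i → i))
  (trans (QS.∑-single N _ j d≤N (λ i i≢j → cong ιℕ (divisorTerm-≢ (suc m) N p (suc i) (other i i≢j))))
         (cong ιℕ (divisorTerm-≡ (suc m) N p (suc j) nd≡N)))
  where
  other : ∀ i → i ≢ j → suc m ℕ.* suc i ≢ N
  other i i≢j e = i≢j (ℕP.suc-injective (ℕP.*-cancelˡ-≡ (suc i) (suc j) (suc m) (trans e (sym nd≡N))))

bracket1-count : ∀ p N → ιℕ (bracketCount (suc p ∷ []) (suc N) N) ≡ QS.∑ N (λ m → ιℕ (divisorSum (suc m) N p))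
bracket1-count p N = trans (cong ιℕ (sum-concatMap _ (range1 N))) (ιℕ-sum (λ n → divisorSum n N p) N (λ i → i))
  where
  sum-concatMap : ∀ {A : Set} (h : A → List ℕ) xs → sumℕ (concatMap h xs) ≡ sumℕ (map (λ x → sumℕ (h x)) xs)
  sum-concatMap h []       = refl
  sum-concatMap h (x ∷ xs) = trans (ℕL.sum-++ (h x) (concatMap h xs)) (cong (sumℕ (h x) ℕ.+_) (sum-concatMap h xs))

-- Σ_N (Σ_{n d = N} dᵖ) qᴺ = p! [p+1].
divisorSeries-weight : ∀ p → 1 ≤ p → HasWeight (suc p) (λ N → QS.∑ N (λ m → ιℕ (divisorSum (suc m) N p)))
divisorSeries-weight p (s≤s z≤n) =
  (ιℕ (p ℕ.!) , (suc p ∷ []) ∷ []) ∷ [] ,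
  (((s≤s (s≤s z≤n) ∷ []) ∷ []) , trans (ℕP.+-identityʳ (suc p ℕ.+ 0)) (ℕP.+-identityʳ (suc p))) ∷ [] ,
  λ N → begin
    ιℕ (p ℕ.!) ℚ.* prodS (bracket (suc p ∷ []) ∷ []) N ℚ.+ 0ℚ
      ≡⟨ ℚP.+-identityʳ _ ⟩
    ιℕ (p ℕ.!) ℚ.* prodS (bracket (suc p ∷ []) ∷ []) N
      ≡⟨ cong (ιℕ (p ℕ.!) ℚ.*_) (trans (prodS≗∏ˢ (bracket (suc p ∷ []) ∷ []) N)
                                        (QS.✶-identityʳ (bracket (suc p ∷ [])) N)) ⟩
    ιℕ (p ℕ.!) ℚ.* (inv! p ℚ.* 1ℚ ℚ.* X N)
      ≡⟨ cong (λ z → ιℕ (p ℕ.!) ℚ.* (z ℚ.* X N)) (ℚP.*-identityʳ (inv! p)) ⟩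
    ιℕ (p ℕ.!) ℚ.* (inv! p ℚ.* X N)
      ≡⟨ ℚP.*-assoc (ιℕ (p ℕ.!)) (inv! p) (X N) ⟨
    ιℕ (p ℕ.!) ℚ.* inv! p ℚ.* X N
      ≡⟨ cong (ℚ._* X N) (ιℕ-!-*-inv! p) ⟩
    1ℚ ℚ.* X N
      ≡⟨ ℚP.*-identityˡ (X N) ⟩
    X N
      ≡⟨ bracket1-count p N ⟩
    QS.∑ N (λ m → ιℕ (divisorSum (suc m) N p)) ∎
  where
  open ≡-Reasoning
  X : ℕ → ℚ
  X N = ιℕ (bracketCount (suc p ∷ []) (suc N) N)

module InfiniteProduct (k : ℕ) where

  open Jets ℚ-ring (Vars k)
  module JS = PowerSeries jetRing

  -- Jets of exponential polynomials

  exp : Form k → Jet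
  exp L []      = 1ℚ
  exp L (v ∷ w) = ι (L v) ℚ.* exp L w

  exp-cong : ∀ {L M} → (∀ v → L v ≡ M v) → exp L ≗ exp M
  exp-cong h []      = refl
  exp-cong h (v ∷ w) = cong₂ ℚ._*_ (cong ι (h v)) (exp-cong h w)

  exp-0F : exp 0F ≗ 1ʲ
  exp-0F []      = refl
  exp-0F (v ∷ w) = ℚP.*-zeroˡ (exp 0F w)

  exp-+F : ∀ L M → exp (L +F M) ≗ exp L ⊛ exp M
  exp-+F L M []      = sym (ℚP.*-identityˡ 1ℚ)
  exp-+F L M (v ∷ w) = begin
    ι ((L +F M) v) ℚ.* exp (L +F M) w
      ≡⟨ cong₂ ℚ._*_ (ι-+ (L v) (M v)) (exp-+F L M w) ⟩
    (ι (L v) ℚ.+ ι (M v)) ℚ.* (exp L ⊛ exp M) w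
      ≡⟨ ℚP.*-distribʳ-+ ((exp L ⊛ exp M) w) (ι (L v)) (ι (M v)) ⟩
    ι (L v) ℚ.* (exp L ⊛ exp M) w ℚ.+ ι (M v) ℚ.* (exp L ⊛ exp M) w
      ≡⟨ sym (cong₂ ℚ._+_ (⋅-⊛ (ι (L v)) (exp L) (exp M) w) (⊛-⋅ (ι (M v)) (exp L) (exp M) w)) ⟩
    (∂ v (exp L) ⊛ exp M) w ℚ.+ (exp L ⊛ ∂ v (exp M)) w ∎
    where open ≡-Reasoning

  exp-•F : ∀ c L w → exp (c •F L) w ≡ (ιℕ c ^ℚ length w) ℚ.* exp L w
  exp-•F c L []      = sym (ℚP.*-identityˡ 1ℚ)
  exp-•F c L (v ∷ w) = trans (cong₂ ℚ._*_ (ι-* (+ c) (L v)) (exp-•F c L w))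
                             (ℚ-*-interchange (ιℕ c) (ι (L v)) _ _)

  jet : ExpPoly k → Jet
  jet []            w = 0ℚ
  jet ((c , L) ∷ P) w = c ℚ.* exp L w ℚ.+ jet P w

  jet-++ : ∀ P Q → jet (P ++ Q) ≗ jet P +ʲ jet Q
  jet-++ []            Q w = sym (ℚP.+-identityˡ _)
  jet-++ ((c , L) ∷ P) Q w =
    trans (cong (c ℚ.* exp L w ℚ.+_) (jet-++ P Q w)) (sym (ℚP.+-assoc (c ℚ.* exp L w) (jet P w) (jet Q w)))

  private
    jet-shift : ∀ c L (g : ℚ × Form k → ℚ × Form k) → (∀ d M → g (d , M) ≡ (c ℚ.* d , L +F M)) →
                ∀ Q → jet (map g Q) ≗ c ⋅ (exp L ⊛ jet Q)
    jet-shift c L g hg []            w =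
      sym (trans (cong (c ℚ.*_) (trans (⊛-comm (exp L) 0ʲ w) (⊛-zeroˡ (exp L) w))) (ℚP.*-zeroʳ c))
    jet-shift c L g hg ((d , M) ∷ Q) w rewrite hg d M = begin
      c ℚ.* d ℚ.* exp (L +F M) w ℚ.+ jet (map g Q) w
        ≡⟨ cong₂ ℚ._+_ (trans (ℚP.*-assoc c d _) (cong (λ z → c ℚ.* (d ℚ.* z)) (exp-+F L M w)))
                       (jet-shift c L g hg Q w) ⟩
      c ℚ.* (d ℚ.* (exp L ⊛ exp M) w) ℚ.+ c ℚ.* (exp L ⊛ jet Q) w
        ≡⟨ sym (ℚP.*-distribˡ-+ c _ _) ⟩
      c ℚ.* (d ℚ.* (exp L ⊛ exp M) w ℚ.+ (exp L ⊛ jet Q) w)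
        ≡⟨ cong (λ z → c ℚ.* (z ℚ.+ (exp L ⊛ jet Q) w)) (sym (⊛-⋅ d (exp L) (exp M) w)) ⟩
      c ℚ.* ((exp L ⊛ d ⋅ exp M) w ℚ.+ (exp L ⊛ jet Q) w)
        ≡⟨ cong (c ℚ.*_) (sym (⊛-distribˡ (exp L) (d ⋅ exp M) (jet Q) w)) ⟩
      c ℚ.* (exp L ⊛ (d ⋅ exp M +ʲ jet Q)) w ∎
      where open ≡-Reasoning

    jet-concatMap : ∀ Q (h : ℚ × Form k → ExpPoly k) → (∀ c L → jet (h (c , L)) ≗ c ⋅ (exp L ⊛ jet Q)) →
                    ∀ P → jet (concatMap h P) ≗ jet P ⊛ jet Q
    jet-concatMap Q h hh []            w = sym (⊛-zeroˡ (jet Q) w)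
    jet-concatMap Q h hh ((c , L) ∷ P) w = begin
      jet (h (c , L) ++ concatMap h P) w
        ≡⟨ jet-++ (h (c , L)) (concatMap h P) w ⟩
      jet (h (c , L)) w ℚ.+ jet (concatMap h P) w
        ≡⟨ cong₂ ℚ._+_ (hh c L w) (jet-concatMap Q h hh P w) ⟩
      c ℚ.* (exp L ⊛ jet Q) w ℚ.+ (jet P ⊛ jet Q) w
        ≡⟨ cong (ℚ._+ (jet P ⊛ jet Q) w) (sym (⋅-⊛ c (exp L) (jet Q) w)) ⟩
      (c ⋅ exp L ⊛ jet Q) w ℚ.+ (jet P ⊛ jet Q) w
        ≡⟨ sym (⊛-distribʳ (jet Q) (c ⋅ exp L) (jet P) w) ⟩
      ((c ⋅ exp L +ʲ jet P) ⊛ jet Q) w ∎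
      where open ≡-Reasoning

  jet-*E : ∀ P Q → jet (P *E Q) ≗ jet P ⊛ jet Q
  jet-*E P Q = jet-concatMap Q _ (λ c L → jet-shift c L _ (λ d M → refl) Q) P

  ∑-at : ∀ n (A : ℕ → Jet) w → JS.∑ n A w ≡ QS.∑ n (λ i → A i w)
  ∑-at zero    A w = refl
  ∑-at (suc n) A w = cong (A 0 w ℚ.+_) (∑-at n (λ i → A (suc i)) w)

  JetSeries : Set
  JetSeries = JS.Seq

  infixl 7 _⋆_
  _⋆_ : JetSeries → JetSeries → JetSeries
  _⋆_ = JS._✶_

  jetSeries : QSeries k → JetSeries
  jetSeries G N = jet (G N)

  jetSeries-*Q : ∀ G H → jetSeries (G *Q H) JS.≐ jetSeries G ⋆ jetSeries H
  jetSeries-*Q G H N w = begin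
    jet (concatMap (λ i → G i *E H (N ∸ i)) (range N)) w
      ≡⟨ concatMap-sum (range N) ⟩
    List.foldr (λ i r → jet (G i *E H (N ∸ i)) w ℚ.+ r) 0ℚ (range N)
      ≡⟨ foldr-upTo (suc N) (λ i → i) ⟩
    QS.∑ (suc N) (λ i → jet (G i *E H (N ∸ i)) w)
      ≡⟨ QS.∑-congᵢ (suc N) (λ i → jet-*E (G i) (H (N ∸ i)) w) ⟩
    QS.∑ (suc N) (λ i → (jet (G i) ⊛ jet (H (N ∸ i))) w)
      ≡⟨ ∑-at (suc N) (λ i → jet (G i) ⊛ jet (H (N ∸ i))) w ⟨
    (jetSeries G ⋆ jetSeries H) N w ∎
    where
    open ≡-Reasoning
    F : ℕ → ℚ
    F i = jet (G i *E H (N ∸ i)) w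
    concatMap-sum : ∀ is → jet (concatMap (λ i → G i *E H (N ∸ i)) is) w ≡ List.foldr (λ i r → F i ℚ.+ r) 0ℚ is
    concatMap-sum []       = refl
    concatMap-sum (i ∷ is) = trans (jet-++ (G i *E H (N ∸ i)) _ w) (cong (F i ℚ.+_) (concatMap-sum is))
    foldr-upTo : ∀ n (f : ℕ → ℕ) → List.foldr (λ i r → F i ℚ.+ r) 0ℚ (applyUpTo f n) ≡ QS.∑ n (λ i → F (f i))
    foldr-upTo zero    f = refl
    foldr-upTo (suc n) f = cong (F (f 0) ℚ.+_) (foldr-upTo n (λ i → f (suc i)))

  jetSeries-oneQ : jetSeries oneQ JS.≐ JS.𝟙
  jetSeries-oneQ zero    []      = refl
  jetSeries-oneQ zero    (v ∷ w) = trans (ℚP.+-identityʳ _) (trans (ℚP.*-identityˡ _) (exp-0F (v ∷ w)))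
  jetSeries-oneQ (suc N) w       = refl

  jetSeries-prodQ : ∀ Gs → jetSeries (prodQ Gs) JS.≐ JS.∏ˢ (map jetSeries Gs)
  jetSeries-prodQ []       = jetSeries-oneQ
  jetSeries-prodQ (G ∷ Gs) = JS.≐-trans (jetSeries-*Q G (prodQ Gs)) (JS.✶-congʳ (jetSeries G) (jetSeries-prodQ Gs))

  open import Algebra.Properties.Ring (CommutativeRing.ring jetRing) using (-‿distribˡ-*)

  -- Logarithmic derivatives of the factors

  ∂ˢ : Vars k → JetSeries → JetSeries
  ∂ˢ v A N = ∂ v (A N)

  ∂ˢ-cong : ∀ v {A B} → A JS.≐ B → ∂ˢ v A JS.≐ ∂ˢ v B
  ∂ˢ-cong v p N w = p N (v ∷ w)

  ∂ˢ-⋆ : ∀ v A B → ∂ˢ v (A ⋆ B) JS.≐ ∂ˢ v A ⋆ B JS.⊕ A ⋆ ∂ˢ v B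
  ∂ˢ-⋆ v A B N w = begin
    JS.∑ (suc N) (λ i → A i ⊛ B (N ∸ i)) (v ∷ w)
      ≡⟨ ∑-at (suc N) (λ i → A i ⊛ B (N ∸ i)) (v ∷ w) ⟩
    QS.∑ (suc N) (λ i → (∂ v (A i) ⊛ B (N ∸ i)) w ℚ.+ (A i ⊛ ∂ v (B (N ∸ i))) w)
      ≡⟨ QS.∑-+ (suc N) (λ i → (∂ v (A i) ⊛ B (N ∸ i)) w) (λ i → (A i ⊛ ∂ v (B (N ∸ i))) w) ⟩
    QS.∑ (suc N) (λ i → (∂ v (A i) ⊛ B (N ∸ i)) w) ℚ.+ QS.∑ (suc N) (λ i → (A i ⊛ ∂ v (B (N ∸ i))) w)
      ≡⟨ sym (cong₂ ℚ._+_ (∑-at (suc N) (λ i → ∂ˢ v A i ⊛ B (N ∸ i)) w)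
                          (∑-at (suc N) (λ i → A i ⊛ ∂ˢ v B (N ∸ i)) w)) ⟩
    (∂ˢ v A ⋆ B JS.⊕ A ⋆ ∂ˢ v B) N w ∎
    where open ≡-Reasoning

  ∂ˢ-𝟙 : ∀ v → ∂ˢ v JS.𝟙 JS.≐ JS.𝟘
  ∂ˢ-𝟙 v zero    w = refl
  ∂ˢ-𝟙 v (suc N) w = refl

  ∂ˢ-mono : ∀ v m F → ∂ˢ v (JS.mono m F) JS.≐ JS.mono m (∂ v F)
  ∂ˢ-mono v zero    F zero    w = refl
  ∂ˢ-mono v zero    F (suc N) w = refl
  ∂ˢ-mono v (suc m) F zero    w = refl
  ∂ˢ-mono v (suc m) F (suc N) w = ∂ˢ-mono v m F N w

  infixr 8 _◃_
  _◃_ : ℚ → JetSeries → JetSeries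
  c ◃ A = (c ⋅ 1ʲ) JS.· A

  ◃-at : ∀ c A N → (c ◃ A) N ≗ c ⋅ A N
  ◃-at c A N w = trans (⋅-⊛ c 1ʲ (A N) w) (cong (c ℚ.*_) (⊛-identityˡ (A N) w))

  -- 1 − e^L qⁿ and 1 / (1 − e^L qⁿ), with n = suc m
  numJ denJ : ℕ → Form k → JetSeries
  numJ m L = jetSeries (numFactor L (suc m))
  denJ m L = jetSeries (denFactor L (suc m))

  numJ-mono : ∀ m L → numJ m L JS.≐ JS.mono 0 1ʲ JS.⊕ JS.mono (suc m) (-ʲ exp L)
  numJ-mono m L zero    w = trans (ℚP.+-identityʳ _) (trans (ℚP.*-identityˡ _) (trans (exp-0F w) (sym (ℚP.+-identityʳ _))))
  numJ-mono m L (suc N) w = trans (at (N ℕ.≡ᵇ m)) (cong (λ F → 0ℚ ℚ.+ F w) (sym (JS.mono-≡ᵇ m (-ʲ exp L) N)))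
    where
    at : (b : Bool) → jet (if b then (ℚ.- 1ℚ , L) ∷ [] else []) w ≡ 0ℚ ℚ.+ (if b then -ʲ exp L else 0ʲ) w
    at true  = trans (ℚP.+-identityʳ _) (trans (sym (ℚP.neg-distribˡ-* 1ℚ (exp L w)))
                 (trans (cong ℚ.-_ (ℚP.*-identityˡ (exp L w))) (sym (ℚP.+-identityˡ _))))
    at false = sym (ℚP.+-identityˡ 0ℚ)

  denJ-∣ : ∀ m L N → suc m ∣ N → denJ m L N ≗ exp ((N / suc m) •F L)
  denJ-∣ m L N n∣N w with does (suc m ∣? N) | dec-true (suc m ∣? N) n∣N
  ... | .true | refl = trans (ℚP.+-identityʳ _) (ℚP.*-identityˡ _)

  denJ-∤ : ∀ m L N → ¬ (suc m ∣ N) → denJ m L N ≗ 0ʲ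
  denJ-∤ m L N n∤N w with does (suc m ∣? N) | dec-false (suc m ∣? N) n∤N
  ... | .false | refl = refl

  denJ-0 : ∀ m L → denJ m L 0 ≗ 1ʲ
  denJ-0 m L w = trans (denJ-∣ m L 0 (suc m ∣0) w)
    (trans (exp-cong (λ v → cong (λ z → + z ℤ.* L v) (0/n≡0 (suc m))) w) (exp-0F w))

  denJ-< : ∀ m L N → 0 < N → N < suc m → denJ m L N ≗ 0ʲ
  denJ-< m L N 0<N N<n = denJ-∤ m L N (λ n∣N → ℕP.<⇒≱ N<n (∣⇒≤ {{ℕ.>-nonZero 0<N}} n∣N))

  •F-suc : ∀ q (L : Form k) v → (suc q •F L) v ≡ (L +F (q •F L)) v
  •F-suc q L v = trans (cong (ℤ._* L v) (ℤP.pos-+ 1 q))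
    (trans (ℤP.*-distribʳ-+ (L v) (+ 1) (+ q)) (cong (ℤ._+ (+ q ℤ.* L v)) (ℤP.*-identityˡ (L v))))

  -- 1/(1 − x qⁿ) = 1 + x qⁿ/(1 − x qⁿ), read off coefficientwise.
  denJ-step : ∀ m L N → suc m ≤ N → denJ m L N ≗ exp L ⊛ denJ m L (N ∸ suc m)
  denJ-step m L N n≤N w = by-divisibility (n ∣? M)
    where
    n = suc m
    M = N ∸ n
    N≡n+M : N ≡ n ℕ.+ M
    N≡n+M = sym (ℕP.m+[n∸m]≡n n≤N)
    by-divisibility : Dec (n ∣ M) → denJ m L N w ≡ (exp L ⊛ denJ m L M) w
    by-divisibility (yes n∣M) = begin
      denJ m L N w                  ≡⟨ denJ-∣ m L N (∣m∸n∣n⇒∣m n n≤N n∣M (∣-refl {n})) w ⟩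
      exp ((N / n) •F L) w          ≡⟨ exp-cong split w ⟩
      exp (L +F ((M / n) •F L)) w   ≡⟨ exp-+F L ((M / n) •F L) w ⟩
      (exp L ⊛ exp ((M / n) •F L)) w ≡⟨ ⊛-cong (λ _ → refl) (denJ-∣ m L M n∣M) w ⟨
      (exp L ⊛ denJ m L M) w        ∎
      where
      open ≡-Reasoning
      split : ∀ v → ((N / n) •F L) v ≡ (L +F ((M / n) •F L)) v
      split v = trans (cong (λ z → + z ℤ.* L v) (m/n≡1+[m∸n]/n n≤N)) (•F-suc (M / n) L v)
    by-divisibility (no n∤M) = trans (denJ-∤ m L N n∤N w)
      (sym (trans (⊛-cong (λ _ → refl) (denJ-∤ m L M n∤M) w) (trans (⊛-comm (exp L) 0ʲ w) (⊛-zeroˡ (exp L) w))))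
      where
      n∤N : ¬ (n ∣ N)
      n∤N n∣N = n∤M (∣m+n∣m⇒∣n (subst (n ∣_) N≡n+M n∣N) (∣-refl {n}))

  numJ-⋆-denJ : ∀ m L → numJ m L ⋆ denJ m L JS.≐ JS.𝟙
  numJ-⋆-denJ m L N w = begin
    (numJ m L ⋆ denJ m L) N w
      ≡⟨ JS.✶-congˡ (denJ m L) (numJ-mono m L) N w ⟩
    ((JS.mono 0 1ʲ JS.⊕ JS.mono n (-ʲ exp L)) ⋆ denJ m L) N w
      ≡⟨ JS.✶-distribʳ (denJ m L) (JS.mono 0 1ʲ) (JS.mono n (-ʲ exp L)) N w ⟩
    (JS.mono 0 1ʲ ⋆ denJ m L) N w ℚ.+ (JS.mono n (-ʲ exp L) ⋆ denJ m L) N w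
      ≡⟨ cong (ℚ._+ (JS.mono n (-ʲ exp L) ⋆ denJ m L) N w)
              (trans (JS.mono-✶-≥ 0 1ʲ (denJ m L) N z≤n w) (⊛-identityˡ (denJ m L N) w)) ⟩
    denJ m L N w ℚ.+ (JS.mono n (-ʲ exp L) ⋆ denJ m L) N w
      ≡⟨ by-size N (N ℕ.<? n) ⟩
    JS.𝟙 N w ∎
    where
    open ≡-Reasoning
    n = suc m
    by-size : ∀ N → Dec (N < n) → denJ m L N w ℚ.+ (JS.mono n (-ʲ exp L) ⋆ denJ m L) N w ≡ JS.𝟙 N w
    by-size zero (yes N<n) =
      trans (cong₂ ℚ._+_ (denJ-0 m L w) (JS.mono-✶-< n (-ʲ exp L) (denJ m L) zero N<n w)) (ℚP.+-identityʳ _)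
    by-size (suc N) (yes N<n) =
      trans (cong₂ ℚ._+_ (denJ-< m L (suc N) (s≤s z≤n) N<n w) (JS.mono-✶-< n (-ʲ exp L) (denJ m L) (suc N) N<n w))
            (ℚP.+-identityʳ _)
    by-size zero (no N≮n) = ⊥-elim (N≮n (s≤s z≤n))
    by-size (suc N) (no N≮n) = begin
      denJ m L (suc N) w ℚ.+ (JS.mono n (-ʲ exp L) ⋆ denJ m L) (suc N) w
        ≡⟨ cong (denJ m L (suc N) w ℚ.+_) (JS.mono-✶-≥ n (-ʲ exp L) (denJ m L) (suc N) n≤N w) ⟩
      denJ m L (suc N) w ℚ.+ (-ʲ exp L ⊛ denJ m L (suc N ∸ n)) w
        ≡⟨ cong (denJ m L (suc N) w ℚ.+_) (-‿distribˡ-* (exp L) (denJ m L (suc N ∸ n)) w) ⟨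
      denJ m L (suc N) w ℚ.+ ℚ.- (exp L ⊛ denJ m L (suc N ∸ n)) w
        ≡⟨ cong (λ z → denJ m L (suc N) w ℚ.+ ℚ.- z) (denJ-step m L (suc N) n≤N w) ⟨
      denJ m L (suc N) w ℚ.+ ℚ.- denJ m L (suc N) w
        ≡⟨ ℚP.+-inverseʳ (denJ m L (suc N) w) ⟩
      0ℚ ∎
      where
      n≤N : n ≤ suc N
      n≤N = ℕP.≮⇒≥ N≮n

  -- e^L qⁿ/(1 − e^L qⁿ) = Σ_{a ≥ 1} e^{aL} q^{na}
  ratio : ℕ → Form k → JetSeries
  ratio m L = JS.mono (suc m) (exp L) ⋆ denJ m L

  denJ-value : ∀ m L N u → 0 < N → denJ m L N u ≡ ιℕ (divisorSum (suc m) N (length u)) ℚ.* exp L u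
  denJ-value m L N u 0<N with suc m ∣? N
  ... | yes n∣N = begin
    denJ m L N u
      ≡⟨ denJ-∣ m L N n∣N u ⟩
    exp (d •F L) u
      ≡⟨ exp-•F d L u ⟩
    (ιℕ d ^ℚ length u) ℚ.* exp L u
      ≡⟨ cong (ℚ._* exp L u) (ιℕ-^ d (length u)) ⟨
    ιℕ (d ℕ.^ length u) ℚ.* exp L u
      ≡⟨ cong (ℚ._* exp L u) (divisorSum-∣ m N (length u) d nd≡N 1≤d (m/n≤m N (suc m))) ⟨
    ιℕ (divisorSum (suc m) N (length u)) ℚ.* exp L u ∎
    where
    open ≡-Reasoning
    d = N / suc m
    nd≡N : suc m ℕ.* d ≡ N
    nd≡N = m*[n/m]≡n n∣N
    1≤d : 1 ≤ d
    1≤d = ℕP.n≢0⇒n>0 (λ d≡0 → ℕP.<⇒≢ 0<N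
      (trans (sym (ℕP.*-zeroʳ (suc m))) (trans (cong (suc m ℕ.*_) (sym d≡0)) nd≡N)))
  ... | no n∤N = trans (denJ-∤ m L N n∤N u)
    (sym (trans (cong (ℚ._* exp L u) (divisorSum-∤ (suc m) N (length u) no-divisor)) (ℚP.*-zeroˡ (exp L u))))
    where
    no-divisor : ∀ d → 1 ≤ d → suc m ℕ.* d ≢ N
    no-divisor d _ nd≡N = n∤N (divides d (trans (sym nd≡N) (ℕP.*-comm (suc m) d)))

  ratio-value : ∀ m L N u → ratio m L N u ≡ ιℕ (divisorSum (suc m) N (length u)) ℚ.* exp L u
  ratio-value m L N u with N ℕ.<? suc m
  ... | yes N<n = trans (JS.mono-✶-< (suc m) (exp L) (denJ m L) N N<n u)
    (sym (trans (cong (ℚ._* exp L u) (divisorSum-∤ (suc m) N (length u) too-big)) (ℚP.*-zeroˡ (exp L u))))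
    where
    too-big : ∀ d → 1 ≤ d → suc m ℕ.* d ≢ N
    too-big d 1≤d nd≡N = ℕP.<⇒≱ N<n (subst (suc m ≤_) nd≡N (ℕP.m≤m*n (suc m) d {{ℕ.>-nonZero 1≤d}}))
  ... | no N≮n = trans (JS.mono-✶-≥ (suc m) (exp L) (denJ m L) N n≤N u)
    (trans (sym (denJ-step m L N n≤N u)) (denJ-value m L N u (ℕP.<-≤-trans (s≤s z≤n) n≤N)))
    where
    n≤N : suc m ≤ N
    n≤N = ℕP.≮⇒≥ N≮n

  ∂ˢ-numJ : ∀ v m L → ∂ˢ v (numJ m L) JS.≐ (ℚ.- ι (L v)) ◃ JS.mono (suc m) (exp L)
  ∂ˢ-numJ v m L = begin
    ∂ˢ v (numJ m L)
      ≈⟨ ∂ˢ-cong v (numJ-mono m L) ⟩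
    ∂ˢ v (JS.mono 0 1ʲ) JS.⊕ ∂ˢ v (JS.mono (suc m) (-ʲ exp L))
      ≈⟨ JS.⊕-cong (∂ˢ-mono v 0 1ʲ) (∂ˢ-mono v (suc m) (-ʲ exp L)) ⟩
    JS.mono 0 0ʲ JS.⊕ JS.mono (suc m) (∂ v (-ʲ exp L))
      ≈⟨ JS.⊕-cong (JS.mono-0# 0) (JS.mono-cong (suc m) (λ u →
           trans (ℚP.neg-distribˡ-* (ι (L v)) (exp L u)) (sym (◃-at c (λ _ → exp L) 0 u)))) ⟩
    JS.𝟘 JS.⊕ JS.mono (suc m) ((c ⋅ 1ʲ) ⊛ exp L)
      ≈⟨ (λ N w → ℚP.+-identityˡ _) ⟩
    JS.mono (suc m) ((c ⋅ 1ʲ) ⊛ exp L)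
      ≈⟨ JS.mono-* (suc m) (c ⋅ 1ʲ) (exp L) ⟩
    c ◃ JS.mono (suc m) (exp L) ∎
    where
    open import Relation.Binary.Reasoning.Setoid JS.≐-setoid
    c = ℚ.- ι (L v)

  ∂ˢ-numJ-log : ∀ v m L → ∂ˢ v (numJ m L) JS.≐ numJ m L ⋆ (ℚ.- ι (L v)) ◃ ratio m L
  ∂ˢ-numJ-log v m L = JS.≐-sym (begin
    numJ m L ⋆ c ◃ ratio m L         ≈⟨ JS.✶-· (c ⋅ 1ʲ) (numJ m L) (ratio m L) ⟩
    c ◃ (numJ m L ⋆ (X ⋆ denJ m L))  ≈⟨ JS.·-congˡ (c ⋅ 1ʲ) (JS.✶-lcomm (numJ m L) X (denJ m L)) ⟩
    c ◃ (X ⋆ (numJ m L ⋆ denJ m L))  ≈⟨ JS.·-congˡ (c ⋅ 1ʲ) (JS.✶-congʳ X (numJ-⋆-denJ m L)) ⟩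
    c ◃ (X ⋆ JS.𝟙)                   ≈⟨ JS.·-congˡ (c ⋅ 1ʲ) (JS.✶-identityʳ X) ⟩
    c ◃ X                            ≈⟨ ∂ˢ-numJ v m L ⟨
    ∂ˢ v (numJ m L)                  ∎)
    where
    open import Relation.Binary.Reasoning.Setoid JS.≐-setoid
    c = ℚ.- ι (L v)
    X = JS.mono (suc m) (exp L)

  -- Differentiating numJ ⋆ denJ = 𝟙 gives numJ ⋆ ∂ denJ = − ∂ numJ ⋆ denJ.
  numJ-⋆-∂denJ : ∀ v m L → numJ m L ⋆ ∂ˢ v (denJ m L) JS.≐ ι (L v) ◃ ratio m L
  numJ-⋆-∂denJ v m L N w = begin
    (U ⋆ ∂ˢ v D) N w                ≡⟨ inverseʳ-unique ((∂ˢ v U ⋆ D) N w) _ (leibniz N w) ⟩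
    ℚ.- (∂ˢ v U ⋆ D) N w            ≡⟨ cong ℚ.-_ (JS.✶-congˡ D (∂ˢ-numJ v m L) N w) ⟩
    ℚ.- (c ◃ X ⋆ D) N w             ≡⟨ cong ℚ.-_ (JS.·-✶ (c ⋅ 1ʲ) X D N w) ⟩
    ℚ.- (c ◃ ratio m L) N w         ≡⟨ cong ℚ.-_ (◃-at c (ratio m L) N w) ⟩
    ℚ.- (c ℚ.* ratio m L N w)       ≡⟨ ℚP.neg-distribˡ-* c (ratio m L N w) ⟩
    ℚ.- c ℚ.* ratio m L N w         ≡⟨ cong (ℚ._* ratio m L N w) (⁻¹-involutive (ι (L v))) ⟩
    ι (L v) ℚ.* ratio m L N w       ≡⟨ ◃-at (ι (L v)) (ratio m L) N w ⟨
    (ι (L v) ◃ ratio m L) N w       ∎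
    where
    open ≡-Reasoning
    U = numJ m L
    D = denJ m L
    X = JS.mono (suc m) (exp L)
    c = ℚ.- ι (L v)
    leibniz : ∂ˢ v U ⋆ D JS.⊕ U ⋆ ∂ˢ v D JS.≐ JS.𝟘
    leibniz = JS.≐-trans (JS.≐-sym (∂ˢ-⋆ v U D)) (JS.≐-trans (∂ˢ-cong v (numJ-⋆-denJ m L)) (∂ˢ-𝟙 v))

  ∂ˢ-denJ-log : ∀ v m L → ∂ˢ v (denJ m L) JS.≐ denJ m L ⋆ ι (L v) ◃ ratio m L
  ∂ˢ-denJ-log v m L = begin
    ∂ˢ v D                 ≈⟨ JS.✶-identityˡ (∂ˢ v D) ⟨
    JS.𝟙 ⋆ ∂ˢ v D          ≈⟨ JS.✶-congˡ (∂ˢ v D) (JS.≐-trans (JS.✶-comm D U) (numJ-⋆-denJ m L)) ⟨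
    D ⋆ U ⋆ ∂ˢ v D         ≈⟨ JS.✶-assoc D U (∂ˢ v D) ⟩
    D ⋆ (U ⋆ ∂ˢ v D)       ≈⟨ JS.✶-congʳ D (numJ-⋆-∂denJ v m L) ⟩
    D ⋆ ι (L v) ◃ ratio m L ∎
    where
    open import Relation.Binary.Reasoning.Setoid JS.≐-setoid
    U = numJ m L
    D = denJ m L

  -- num L at m and den L at m stand for 1 − e^L qᵐ⁺¹ and 1/(1 − e^L qᵐ⁺¹).
  data Shape : Set where
    num den : Form k → Shape

  form : Shape → Form k
  form (num L) = L
  form (den L) = L

  slope : Vars k → Shape → ℚ
  slope v (num L) = ℚ.- ι (L v)
  slope v (den L) = ι (L v)

  data Factor : Set where
    _at_ : Shape → ℕ → Factor

  level : Factor → ℕ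
  level (_ at m) = m

  factorQ : Factor → QSeries k
  factorQ (num L at m) = numFactor L (suc m)
  factorQ (den L at m) = denFactor L (suc m)

  factor : Factor → JetSeries
  factor f = jetSeries (factorQ f)

  logDeriv : Vars k → Factor → JetSeries
  logDeriv v (s at m) = slope v s ◃ ratio m (form s)

  ∂ˢ-factor : ∀ v f → ∂ˢ v (factor f) JS.≐ factor f ⋆ logDeriv v f
  ∂ˢ-factor v (num L at m) = ∂ˢ-numJ-log v m L
  ∂ˢ-factor v (den L at m) = ∂ˢ-denJ-log v m L

  ∂ˢ-∏ˢ : ∀ v fs → ∂ˢ v (JS.∏ˢ (map factor fs)) JS.≐ JS.∏ˢ (map factor fs) ⋆ JS.∑ˢ (map (logDeriv v) fs)
  ∂ˢ-∏ˢ v []       = JS.≐-trans (∂ˢ-𝟙 v) (JS.≐-sym (JS.✶-zeroʳ JS.𝟙))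
  ∂ˢ-∏ˢ v (f ∷ fs) = begin
    ∂ˢ v (F ⋆ P)
      ≈⟨ ∂ˢ-⋆ v F P ⟩
    ∂ˢ v F ⋆ P JS.⊕ F ⋆ ∂ˢ v P
      ≈⟨ JS.⊕-cong (JS.✶-congˡ P (∂ˢ-factor v f)) (JS.✶-congʳ F (∂ˢ-∏ˢ v fs)) ⟩
    F ⋆ h ⋆ P JS.⊕ F ⋆ (P ⋆ H)
      ≈⟨ JS.⊕-cong (JS.≐-trans (JS.✶-assoc F h P) (JS.✶-lcomm F h P)) (JS.≐-sym (JS.✶-assoc F P H)) ⟩
    h ⋆ (F ⋆ P) JS.⊕ F ⋆ P ⋆ H
      ≈⟨ JS.⊕-cong (JS.✶-comm h (F ⋆ P)) JS.≐-refl ⟩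
    F ⋆ P ⋆ h JS.⊕ F ⋆ P ⋆ H
      ≈⟨ JS.✶-distribˡ (F ⋆ P) h H ⟨
    F ⋆ P ⋆ (h JS.⊕ H) ∎
    where
    open import Relation.Binary.Reasoning.Setoid JS.≐-setoid
    F = factor f
    h = logDeriv v f
    P = JS.∏ˢ (map factor fs)
    H = JS.∑ˢ (map (logDeriv v) fs)

  numShapes denShapes shapes : List Shape
  numShapes = map (λ j → num (xForm j)) (allFin (suc k))
  denShapes = map (λ j → den (yForm (just j))) (allFin k) ++ den (yForm nothing) ∷ []
  shapes    = numShapes ++ denShapes

  block : ℕ → List Factor
  block m = map (_at m) shapes

  factors : ℕ → List Factor
  factors N = concatMap block (upTo N)

  factorsUpTo-≡ : ∀ N → factorsUpTo k N ≡ map factorQ (factors N)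
  factorsUpTo-≡ N = go (upTo N)
    where
    block-≡ : ∀ m → map factorQ (block m) ≡
         map (λ j → numFactor (xForm j) (suc m)) (allFin (suc k))
      ++ map (λ j → denFactor (yForm (just j)) (suc m)) (allFin k)
      ++ denFactor (yForm nothing) (suc m) ∷ []
    block-≡ m = begin
      map factorQ (map (_at m) shapes)
        ≡⟨ ListP.map-∘ shapes ⟨
      map (λ s → factorQ (s at m)) (numShapes ++ denShapes)
        ≡⟨ ListP.map-++ (λ s → factorQ (s at m)) numShapes denShapes ⟩
      map (λ s → factorQ (s at m)) numShapes ++ map (λ s → factorQ (s at m)) denShapes
        ≡⟨ cong₂ _++_ (ListP.map-∘ (allFin (suc k)))
                      (trans (cong (_++ denFactor (yForm nothing) (suc m) ∷ []) (ListP.map-∘ (allFin k)))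
                             (sym (ListP.map-++ (λ s → factorQ (s at m)) (map (λ j → den (yForm (just j))) (allFin k))
                                                (den (yForm nothing) ∷ [])))) ⟨
      _ ∎
      where open ≡-Reasoning
    go : ∀ ms → concatMap _ (map suc ms) ≡ map factorQ (concatMap block ms)
    go []       = refl
    go (m ∷ ms) = trans (cong₂ _++_ (sym (block-≡ m)) (go ms)) (sym (ListP.map-++ factorQ (block m) (concatMap block ms)))

  block-level : ∀ m → All (λ f → level f ≡ m) (block m)
  block-level m = AllP.map⁺ (All.universal (λ _ → refl) shapes)

  factors-suc : ∀ M → factors (suc M) ≡ factors M ++ block M
  factors-suc M = trans (cong (concatMap block) (sym (ListP.applyUpTo-∷ʳ (λ i → i) M)))
    (trans (ListP.concatMap-++ block (upTo M) (M ∷ [])) (cong (factors M ++_) (ListP.++-identityʳ (block M))))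

  factor-≐[]-𝟙 : ∀ f → factor f JS.≐[ level f ] JS.𝟙
  factor-≐[]-𝟙 (num L at M) N N≤M w = trans (numJ-mono M L N w)
    (trans (cong₂ ℚ._+_ (JS.mono-0-1 N w) (JS.mono-< (suc M) (-ʲ exp L) N (s≤s N≤M) w)) (ℚP.+-identityʳ _))
  factor-≐[]-𝟙 (den L at M) zero    _   = denJ-0 M L
  factor-≐[]-𝟙 (den L at M) (suc N) N≤M = denJ-< M L (suc N) (s≤s z≤n) (s≤s N≤M)

  logDeriv-≐[]-𝟘 : ∀ v f → logDeriv v f JS.≐[ level f ] JS.𝟘
  logDeriv-≐[]-𝟘 v (s at M) N N≤M w = trans (◃-at (slope v s) (ratio M (form s)) N w)
    (trans (cong (slope v s ℚ.*_) (JS.mono-✶-< (suc M) (exp (form s)) (denJ M (form s)) N (s≤s N≤M) w))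
           (ℚP.*-zeroʳ (slope v s)))

  partialProduct : ℕ → JetSeries
  partialProduct M = JS.∏ˢ (map factor (factors M))

  partialLogDeriv : Vars k → ℕ → JetSeries
  partialLogDeriv v M = JS.∑ˢ (map (logDeriv v) (factors M))

  partialProduct-step : ∀ M → partialProduct (suc M) JS.≐[ M ] partialProduct M
  partialProduct-step M =
    JS.≐[]-trans {M} (JS.≐⇒≐[] split)
      (JS.≐[]-trans {M} (JS.✶-cong[] {M} (JS.≐[]-refl {M} {partialProduct M}) new≐𝟙)
                        (JS.≐⇒≐[] (JS.✶-identityʳ (partialProduct M))))
    where
    split : partialProduct (suc M) JS.≐ partialProduct M ⋆ JS.∏ˢ (map factor (block M))
    split N w = trans (cong (λ fs → JS.∏ˢ (map factor fs) N w) (factors-suc M))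
      (trans (cong (λ Fs → JS.∏ˢ Fs N w) (ListP.map-++ factor (factors M) (block M)))
             (JS.∏ˢ-++ (map factor (factors M)) (map factor (block M)) N w))
    new≐𝟙 : JS.∏ˢ (map factor (block M)) JS.≐[ M ] JS.𝟙
    new≐𝟙 = JS.∏ˢ-≐[]-𝟙 (map factor (block M)) (AllP.map⁺ (All.map
      (λ {f} eq → subst (λ l → factor f JS.≐[ l ] JS.𝟙) eq (factor-≐[]-𝟙 f)) (block-level M)))

  partialLogDeriv-step : ∀ v M → partialLogDeriv v (suc M) JS.≐[ M ] partialLogDeriv v M
  partialLogDeriv-step v M N N≤M w = begin
    JS.∑ˢ (map (logDeriv v) (factors (suc M))) N w
      ≡⟨ cong (λ Fs → JS.∑ˢ Fs N w) (trans (cong (map (logDeriv v)) (factors-suc M))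
                                           (ListP.map-++ (logDeriv v) (factors M) (block M))) ⟩
    JS.∑ˢ (map (logDeriv v) (factors M) ++ map (logDeriv v) (block M)) N w
      ≡⟨ JS.∑ˢ-++ (map (logDeriv v) (factors M)) (map (logDeriv v) (block M)) N w ⟩
    partialLogDeriv v M N w ℚ.+ JS.∑ˢ (map (logDeriv v) (block M)) N w
      ≡⟨ cong (partialLogDeriv v M N w ℚ.+_) (new≐𝟘 N N≤M w) ⟩
    partialLogDeriv v M N w ℚ.+ 0ℚ
      ≡⟨ ℚP.+-identityʳ _ ⟩
    partialLogDeriv v M N w ∎
    where
    open ≡-Reasoning
    new≐𝟘 : JS.∑ˢ (map (logDeriv v) (block M)) JS.≐[ M ] JS.𝟘
    new≐𝟘 = JS.∑ˢ-≐[]-𝟘 (map (logDeriv v) (block M)) (AllP.map⁺ (All.map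
      (λ {f} eq → subst (λ l → logDeriv v f JS.≐[ l ] JS.𝟘) eq (logDeriv-≐[]-𝟘 v f)) (block-level M)))

  -- T N w is ∂_w at the origin of the qᴺ-coefficient of the product. Only factors of
  -- level < N contribute to qᴺ, so T and H are read off the partial products along the diagonal.
  T : JetSeries
  T N = partialProduct N N

  H : Vars k → JetSeries
  H v N = partialLogDeriv v N N

  ∂ˢ-T : ∀ v → ∂ˢ v T JS.≐ T ⋆ H v
  ∂ˢ-T v N w = trans (∂ˢ-∏ˢ v (factors N) N w)
    (JS.✶-cong[] {N} {partialProduct N} {T} {partialLogDeriv v N} {H v}
       (λ i i≤N → JS.stabilises partialProduct partialProduct-step i≤N i ℕP.≤-refl)
       (λ i i≤N → JS.stabilises (partialLogDeriv v) (partialLogDeriv-step v) i≤N i ℕP.≤-refl) N ℕP.≤-refl w)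

  jet-prodCoeffQ : ∀ N → jet (prodCoeffQ k N) ≗ T N
  jet-prodCoeffQ N w = trans (cong (λ Gs → jet (prodQ Gs N) w) (factorsUpTo-≡ N))
    (trans (jetSeries-prodQ (map factorQ (factors N)) N w)
           (cong (λ Fs → JS.∏ˢ Fs N w) (sym (ListP.map-∘ (factors N)))))

  -- Weights of jet series

  WeightAt : ℕ → JetSeries → Word → Set
  WeightAt a A u = HasWeight (a ℕ.+ length u) (λ N → A N u)

  ⋆-weight : ∀ w a b A B → (∀ u → length u ≤ length w → WeightAt a A u) →
             (∀ u → length u ≤ length w → WeightAt b B u) → WeightAt (a ℕ.+ b) (A ⋆ B) w
  ⋆-weight []      a b A B hA hB =
    HasWeight-cast (sym (trans (ℕP.+-identityʳ (a ℕ.+ b)) (sym (cong₂ ℕ._+_ (ℕP.+-identityʳ a) (ℕP.+-identityʳ b)))))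
      (HasWeight-resp (λ N → sym (∑-at (suc N) (λ i → A i ⊛ B (N ∸ i)) [])) (HasWeight-✶ (hA [] z≤n) (hB [] z≤n)))
  ⋆-weight (v ∷ w) a b A B hA hB = HasWeight-resp (λ N → sym (∂ˢ-⋆ v A B N w))
    (HasWeight-+ (HasWeight-cast (sym (ℕP.+-suc (a ℕ.+ b) (length w)))
                   (⋆-weight w (suc a) b (∂ˢ v A) B (λ u h → ∂-weight a A u (hA (v ∷ u) (s≤s h))) (shorter hB)))
                 (HasWeight-cast (trans (cong (ℕ._+ length w) (ℕP.+-suc a b)) (sym (ℕP.+-suc (a ℕ.+ b) (length w))))
                   (⋆-weight w a (suc b) A (∂ˢ v B) (shorter hA) (λ u h → ∂-weight b B u (hB (v ∷ u) (s≤s h))))))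
    where
    ∂-weight : ∀ c C u → WeightAt c C (v ∷ u) → WeightAt (suc c) (∂ˢ v C) u
    ∂-weight c C u = HasWeight-cast (ℕP.+-suc c (length u))
    shorter : ∀ {c C} → (∀ u → length u ≤ suc (length w) → WeightAt c C u) →
              ∀ u → length u ≤ length w → WeightAt c C u
    shorter h u u≤w = h u (ℕP.m≤n⇒m≤1+n u≤w)

  slopeExp : Vars k → Word → Shape → ℚ
  slopeExp v u s = slope v s ℚ.* exp (form s) u

  totalSlope : Vars k → Word → ℚ
  totalSlope v u = sumℚ (map (slopeExp v u) shapes)

  -- The only use of x₁ ⋯ x_r = y₁ ⋯ y_r: the first-order part of log T vanishes,
  -- which would otherwise produce the bracket [1], of weight 1 but not in qMZV.
  totalSlope-[] : ∀ v → totalSlope v [] ≡ 0ℚ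
  totalSlope-[] v = begin
    sumℚ (map f (numShapes ++ denShapes))
      ≡⟨ sumℚ-map-++ f numShapes denShapes ⟩
    sumℚ (map f numShapes) ℚ.+ sumℚ (map f (yShapes ++ den (yForm nothing) ∷ []))
      ≡⟨ cong (sumℚ (map f numShapes) ℚ.+_) (sumℚ-map-++ f yShapes (den (yForm nothing) ∷ [])) ⟩
    sumℚ (map f numShapes) ℚ.+ (sumℚ (map f yShapes) ℚ.+ (f (den (yForm nothing)) ℚ.+ 0ℚ))
      ≡⟨ cong₂ (λ a b → a ℚ.+ (b ℚ.+ (f (den (yForm nothing)) ℚ.+ 0ℚ)))
               (cong sumℚ (ListP.map-∘ {g = f} {f = λ j → num (xForm j)} (allFin (suc k))))
               (cong sumℚ (ListP.map-∘ {g = f} {f = λ j → den (yForm (just j))} (allFin k))) ⟨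
    sumℚ (map (λ j → f (num (xForm j))) (allFin (suc k)))
      ℚ.+ (sumℚ (map (λ j → f (den (yForm (just j)))) (allFin k)) ℚ.+ (f (den (yForm nothing)) ℚ.+ 0ℚ))
      ≡⟨ cancel v ⟩
    0ℚ ∎
    where
    open ≡-Reasoning
    f = slopeExp v []
    yShapes = map (λ j → den (yForm (just j))) (allFin k)
    cancel : ∀ v → sumℚ (map (λ j → slopeExp v [] (num (xForm j))) (allFin (suc k)))
      ℚ.+ (sumℚ (map (λ j → slopeExp v [] (den (yForm (just j)))) (allFin k))
      ℚ.+ (slopeExp v [] (den (yForm nothing)) ℚ.+ 0ℚ)) ≡ 0ℚ
    cancel (inj₁ i) = cong₂ (λ a b → a ℚ.+ (b ℚ.+ (slopeExp (inj₁ i) [] (den (yForm nothing)) ℚ.+ 0ℚ)))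
      (sumℚ-allFin-indicator (suc k) i (λ z → ℚ.- ι z ℚ.* 1ℚ) refl) (sumℚ-allFin-0 k _ (λ j → refl))
    cancel (inj₂ i) = cong₂ (λ a b → a ℚ.+ (b ℚ.+ (slopeExp (inj₂ i) [] (den (yForm nothing)) ℚ.+ 0ℚ)))
      (sumℚ-allFin-0 (suc k) _ (λ j → refl)) (sumℚ-allFin-indicator k i (λ z → ι z ℚ.* 1ℚ) refl)

  logDeriv-value : ∀ v s m N u →
    logDeriv v (s at m) N u ≡ ιℕ (divisorSum (suc m) N (length u)) ℚ.* slopeExp v u s
  logDeriv-value v s m N u = begin
    logDeriv v (s at m) N u              ≡⟨ ◃-at (slope v s) (ratio m (form s)) N u ⟩
    slope v s ℚ.* ratio m (form s) N u   ≡⟨ cong (slope v s ℚ.*_) (ratio-value m (form s) N u) ⟩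
    slope v s ℚ.* (d ℚ.* exp (form s) u) ≡⟨ ℚP.*-assoc (slope v s) d _ ⟨
    slope v s ℚ.* d ℚ.* exp (form s) u   ≡⟨ cong (ℚ._* exp (form s) u) (ℚP.*-comm (slope v s) d) ⟩
    d ℚ.* slope v s ℚ.* exp (form s) u   ≡⟨ ℚP.*-assoc d (slope v s) _ ⟩
    d ℚ.* slopeExp v u s                 ∎
    where
    open ≡-Reasoning
    d = ιℕ (divisorSum (suc m) N (length u))

  H-value : ∀ v N u → H v N u ≡ QS.∑ N (λ m → ιℕ (divisorSum (suc m) N (length u))) ℚ.* totalSlope v u
  H-value v N u = begin
    JS.∑ˢ (map (logDeriv v) (factors N)) N u
      ≡⟨ ∑ˢ-at (map (logDeriv v) (factors N)) ⟩
    sumℚ (map (λ F → F N u) (map (logDeriv v) (factors N)))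
      ≡⟨ cong sumℚ (ListP.map-∘ (factors N)) ⟨
    sumℚ (map h (concatMap block (upTo N)))
      ≡⟨ over-levels N (λ i → i) ⟩
    QS.∑ N (λ m → d m ℚ.* totalSlope v u)
      ≡⟨ QS.∑-* N (totalSlope v u) d ⟨
    QS.∑ N d ℚ.* totalSlope v u ∎
    where
    open ≡-Reasoning
    h : Factor → ℚ
    h f = logDeriv v f N u
    d : ℕ → ℚ
    d m = ιℕ (divisorSum (suc m) N (length u))
    ∑ˢ-at : ∀ Fs → JS.∑ˢ Fs N u ≡ sumℚ (map (λ F → F N u) Fs)
    ∑ˢ-at []       = refl
    ∑ˢ-at (F ∷ Fs) = cong (F N u ℚ.+_) (∑ˢ-at Fs)
    on-block : ∀ m → sumℚ (map h (block m)) ≡ d m ℚ.* totalSlope v u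
    on-block m = trans (cong sumℚ (sym (ListP.map-∘ {g = h} {f = _at m} shapes)))
      (trans (cong sumℚ (ListP.map-cong (λ s → logDeriv-value v s m N u) shapes)) (sumℚ-*ˡ (d m) (slopeExp v u) shapes))
    over-levels : ∀ n (g : ℕ → ℕ) →
      sumℚ (map h (concatMap block (applyUpTo g n))) ≡ QS.∑ n (λ i → d (g i) ℚ.* totalSlope v u)
    over-levels zero    g = refl
    over-levels (suc n) g = trans (sumℚ-map-++ h (block (g 0)) _)
      (cong₂ ℚ._+_ (on-block (g 0)) (over-levels n (λ i → g (suc i))))

  H-weight : ∀ v u → WeightAt 1 (H v) u
  H-weight v [] = HasWeight-resp (λ N → sym (trans (H-value v N [])
    (trans (cong (QS.∑ N (λ m → ιℕ (divisorSum (suc m) N 0)) ℚ.*_) (totalSlope-[] v))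
           (ℚP.*-zeroʳ (QS.∑ N (λ m → ιℕ (divisorSum (suc m) N 0)))))))
    (HasWeight-𝟘 1)
  H-weight v u@(_ ∷ _) = HasWeight-resp (λ N → trans (ℚP.*-comm (totalSlope v u) _) (sym (H-value v N u)))
    (HasWeight-· (totalSlope v u) (divisorSeries-weight (length u) (s≤s z≤n)))

  -- The constant term

  ε : JetSeries → Series
  ε A N = A N []

  ε-⋆ : ∀ A B → ε (A ⋆ B) QS.≐ ε A QS.✶ ε B
  ε-⋆ A B N = ∑-at (suc N) (λ i → A i ⊛ B (N ∸ i)) []

  ε-∏ˢ : ∀ As → ε (JS.∏ˢ As) QS.≐ QS.∏ˢ (map ε As)
  ε-∏ˢ []       zero    = refl
  ε-∏ˢ []       (suc N) = refl
  ε-∏ˢ (A ∷ As) = QS.≐-trans (ε-⋆ A (JS.∏ˢ As)) (QS.✶-congʳ (ε A) (ε-∏ˢ As))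

  -- At the empty word every exponential is 1, so the form of a factor is invisible.
  private
    jet-[]-single : ∀ (b : Bool) c (L L' : Form k) →
      jet (if b then (c , L) ∷ [] else []) [] ≡ jet (if b then (c , L') ∷ [] else []) []
    jet-[]-single true  c L L' = refl
    jet-[]-single false c L L' = refl

  ε-num : ∀ L m → ε (factor (num L at m)) QS.≐ ε (numJ m 0F)
  ε-num L m zero    = refl
  ε-num L m (suc N) = jet-[]-single (suc N ℕ.≡ᵇ suc m) (ℚ.- 1ℚ) L 0F

  ε-den : ∀ L m → ε (factor (den L at m)) QS.≐ ε (denJ m 0F)
  ε-den L m N = jet-[]-single (does (suc m ∣? N)) 1ℚ ((N / suc m) •F L) ((N / suc m) •F 0F)

  ε-block : ∀ m → QS.∏ˢ (map ε (map factor (block m))) QS.≐ QS.𝟙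
  ε-block m = QS.≐-trans (λ N → cong (λ As → QS.∏ˢ As N) regroup)
    (QS.∏ˢ-inverse-pairs (ε (numJ m 0F)) (ε (denJ m 0F)) inverse (map φ numShapes) (map φ denShapes)
      same-length
      (AllP.map⁺ (AllP.map⁺ (All.universal (λ j → ε-num (xForm j) m) (allFin (suc k)))))
      (AllP.map⁺ (AllP.++⁺ (AllP.map⁺ (All.universal (λ j → ε-den _ m) (allFin k))) (ε-den _ m ∷ []))))
    where
    φ : Shape → Series
    φ s = ε (factor (s at m))
    yShapes = map (λ j → den (yForm (just j))) (allFin k)
    regroup : map ε (map factor (block m)) ≡ map φ numShapes ++ map φ denShapes
    regroup = trans (sym (ListP.map-∘ (block m))) (trans (sym (ListP.map-∘ shapes)) (ListP.map-++ φ numShapes denShapes))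
    inverse : ε (numJ m 0F) QS.✶ ε (denJ m 0F) QS.≐ QS.𝟙
    inverse = QS.≐-trans (QS.≐-sym (ε-⋆ (numJ m 0F) (denJ m 0F))) (λ N → trans (numJ-⋆-denJ m 0F N []) (𝟙-at-[] N))
      where
      𝟙-at-[] : ∀ N → JS.𝟙 N [] ≡ QS.𝟙 N
      𝟙-at-[] zero    = refl
      𝟙-at-[] (suc N) = refl
    same-length : length (map φ numShapes) ≡ length (map φ denShapes)
    same-length = begin
      length (map φ numShapes)   ≡⟨ ListP.length-map φ numShapes ⟩
      length numShapes           ≡⟨ ListP.length-map _ (allFin (suc k)) ⟩
      length (allFin (suc k))    ≡⟨ ListP.length-tabulate (λ j → j) ⟩
      suc k                      ≡⟨ ℕP.+-comm 1 k ⟩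
      k ℕ.+ 1                    ≡⟨ cong (ℕ._+ 1) (ListP.length-tabulate (λ j → j)) ⟨
      length (allFin k) ℕ.+ 1    ≡⟨ cong (ℕ._+ 1) (ListP.length-map _ (allFin k)) ⟨
      length yShapes ℕ.+ 1       ≡⟨ ListP.length-++ yShapes ⟨
      length denShapes           ≡⟨ ListP.length-map φ denShapes ⟨
      length (map φ denShapes)   ∎
      where open ≡-Reasoning

  T-[] : ∀ N → T N [] ≡ oneS N
  T-[] N = trans (ε-∏ˢ (map factor (factors N)) N) (trans (over-levels (upTo N) N) (𝟙≡oneS N))
    where
    over-levels : ∀ ms → QS.∏ˢ (map ε (map factor (concatMap block ms))) QS.≐ QS.𝟙
    over-levels []       = QS.≐-refl
    over-levels (m ∷ ms) = QS.≐-trans (λ N → cong (λ As → QS.∏ˢ As N) split)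
      (QS.≐-trans (QS.∏ˢ-++ (map ε (map factor (block m))) _)
      (QS.≐-trans (QS.✶-cong (ε-block m) (over-levels ms)) (QS.✶-identityˡ QS.𝟙)))
      where
      split : map ε (map factor (block m ++ concatMap block ms))
            ≡ map ε (map factor (block m)) ++ map ε (map factor (concatMap block ms))
      split = trans (cong (map ε) (ListP.map-++ factor (block m) _)) (ListP.map-++ ε (map factor (block m)) _)
    𝟙≡oneS : ∀ N → QS.𝟙 N ≡ oneS N
    𝟙≡oneS zero    = refl
    𝟙≡oneS (suc N) = refl

  -- Induction on the word: differentiating T brings down a factor H v of weight 1.
  T-weight : ∀ w → WeightAt 0 T w
  T-weight w = go (length w) w ℕP.≤-refl
    where
    go : ∀ n w → length w ≤ n → WeightAt 0 T w
    go n       []      _       = HasWeight-resp (λ N → sym (T-[] N)) HasWeight-oneS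
    go (suc n) (v ∷ w) (s≤s h) = HasWeight-resp (λ N → sym (∂ˢ-T v N w))
      (⋆-weight w 0 1 T (H v) (λ u u≤w → go n u (ℕP.≤-trans u≤w h)) (λ u _ → H-weight v u))

  -- ∂^α f(0) / α! is the coefficient of z^α; wordOf α spells out ∂^α as a word.
  wordOf : (Vars k → ℕ) → Word
  wordOf α = concatMap (λ v → replicate (α v) v) (varList k)

  invFactorials : (Vars k → ℕ) → ℚ
  invFactorials α = prodℚ (map (λ v → inv! (α v)) (varList k))

  exp-wordOf : ∀ α L → exp L (wordOf α) ≡ prodℚ (map (λ v → ι (L v) ^ℚ α v) (varList k))
  exp-wordOf α L = go (varList k)
    where
    exp-++ : ∀ xs ys → exp L (xs ++ ys) ≡ exp L xs ℚ.* exp L ys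
    exp-++ []       ys = sym (ℚP.*-identityˡ _)
    exp-++ (x ∷ xs) ys = trans (cong (ι (L x) ℚ.*_) (exp-++ xs ys)) (sym (ℚP.*-assoc (ι (L x)) (exp L xs) (exp L ys)))
    exp-replicate : ∀ n v → exp L (replicate n v) ≡ ι (L v) ^ℚ n
    exp-replicate zero    v = refl
    exp-replicate (suc n) v = cong (ι (L v) ℚ.*_) (exp-replicate n v)
    go : ∀ vs → exp L (concatMap (λ v → replicate (α v) v) vs) ≡ prodℚ (map (λ v → ι (L v) ^ℚ α v) vs)
    go []       = refl
    go (v ∷ vs) = trans (exp-++ (replicate (α v) v) _) (cong₂ ℚ._*_ (exp-replicate (α v) v) (go vs))

  coeffExp-exp : ∀ α L → coeffExp α L ≡ exp L (wordOf α) ℚ.* invFactorials α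
  coeffExp-exp α L = trans (prodℚ-* (λ v → ι (L v) ^ℚ α v) (λ v → inv! (α v)) (varList k))
                           (cong (ℚ._* invFactorials α) (sym (exp-wordOf α L)))
    where
    prodℚ-* : ∀ {A : Set} (f g : A → ℚ) xs →
              prodℚ (map (λ x → f x ℚ.* g x) xs) ≡ prodℚ (map f xs) ℚ.* prodℚ (map g xs)
    prodℚ-* f g []       = refl
    prodℚ-* f g (x ∷ xs) = trans (cong (f x ℚ.* g x ℚ.*_) (prodℚ-* f g xs)) (ℚ-*-interchange (f x) (g x) _ _)

  coeffE-jet : ∀ α P → coeffE α P ≡ invFactorials α ℚ.* jet P (wordOf α)
  coeffE-jet α []            = sym (ℚP.*-zeroʳ (invFactorials α))
  coeffE-jet α ((c , L) ∷ P) = begin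
    c ℚ.* coeffExp α L ℚ.+ coeffE α P
      ≡⟨ cong₂ ℚ._+_ (cong (c ℚ.*_) (trans (coeffExp-exp α L) (ℚP.*-comm _ K))) (coeffE-jet α P) ⟩
    c ℚ.* (K ℚ.* exp L (wordOf α)) ℚ.+ K ℚ.* jet P (wordOf α)
      ≡⟨ cong (ℚ._+ K ℚ.* jet P (wordOf α)) (swap c K (exp L (wordOf α))) ⟩
    K ℚ.* (c ℚ.* exp L (wordOf α)) ℚ.+ K ℚ.* jet P (wordOf α)
      ≡⟨ ℚP.*-distribˡ-+ K _ _ ⟨
    K ℚ.* jet ((c , L) ∷ P) (wordOf α) ∎
    where
    open ≡-Reasoning
    K = invFactorials α
    swap : ∀ a b c → a ℚ.* (b ℚ.* c) ≡ b ℚ.* (a ℚ.* c)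
    swap a b c = trans (sym (ℚP.*-assoc a b c)) (trans (cong (ℚ._* c) (ℚP.*-comm a b)) (ℚP.*-assoc b a c))

  length-wordOf : ∀ α → length (wordOf α) ≡ totalDeg k α
  length-wordOf α = go (varList k)
    where
    go : ∀ vs → length (concatMap (λ v → replicate (α v) v) vs) ≡ sumℕ (map α vs)
    go []       = refl
    go (v ∷ vs) = trans (ListP.length-++ (replicate (α v) v)) (cong₂ ℕ._+_ (ListP.length-replicate (α v)) (go vs))

  wordOf-0 : wordOf (λ _ → 0) ≡ []
  wordOf-0 = go (varList k)
    where
    go : ∀ (vs : List (Vars k)) → concatMap (λ v → replicate 0 v) vs ≡ []
    go []       = refl
    go (v ∷ vs) = go vs

  invFactorials-0 : invFactorials (λ _ → 0) ≡ 1ℚ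
  invFactorials-0 = go (varList k)
    where
    go : ∀ (vs : List (Vars k)) → prodℚ (map (λ v → inv! 0) vs) ≡ 1ℚ
    go []       = refl
    go (v ∷ vs) = cong (inv! 0 ℚ.*_) (go vs)

  coeffZW-jet : ∀ α N → coeffZW k α N ≡ invFactorials α ℚ.* T N (wordOf α)
  coeffZW-jet α N = trans (coeffE-jet α (prodCoeffQ k N)) (cong (invFactorials α ℚ.*_) (jet-prodCoeffQ N (wordOf α)))

theorem3p3 : (k : ℕ) →
    (∀ N → coeffZW k (λ _ → 0) N ≡ oneS N) ×
    (∀ (α : Vars k → ℕ) → HasWeight (totalDeg k α) (coeffZW k α))
theorem3p3 k = constant-term , weight
  where
  open InfiniteProduct k

  constant-term : ∀ N → coeffZW k (λ _ → 0) N ≡ oneS N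
  constant-term N = begin
    coeffZW k (λ _ → 0) N
      ≡⟨ coeffZW-jet (λ _ → 0) N ⟩
    invFactorials (λ _ → 0) ℚ.* T N (wordOf (λ _ → 0))
      ≡⟨ cong₂ (λ c w → c ℚ.* T N w) invFactorials-0 wordOf-0 ⟩
    1ℚ ℚ.* T N []
      ≡⟨ ℚP.*-identityˡ (T N []) ⟩
    T N []
      ≡⟨ T-[] N ⟩
    oneS N ∎
    where open ≡-Reasoning

  weight : ∀ α → HasWeight (totalDeg k α) (coeffZW k α)
  weight α = HasWeight-resp (λ N → sym (coeffZW-jet α N))
    (HasWeight-· (invFactorials α) (HasWeight-cast (length-wordOf α) (T-weight (wordOf α))))
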